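{- Let $q=p^f>5$ with $p$ odd, let $\omega$ be a primitive element of $GF(q)$, and let $Q_{+1}$, $Q_{ -1}$ be the sets of nonzero squares and non-squares of $GF(q)$. Let $\mathcal{C}:X_0X_2-X_1^2=0$ in $PG(2,q)$, let $I$ be the set of points of $PG(2,q)$ internal to $\mathcal{C}$ (lying on no tangent of $\mathcal{C}$), and let $\alpha,\beta\in PGL(3,q)$ be represented by $\mathrm{diag}(\omega,1,\omega^{ -1})$ and $\begin{pmatrix}0&0&1\\0&-1&0\\1&0&0\end{pmatrix}$. Put $H_0=\langle\alpha^2,\beta\rangle$ and $H_1=\langle\alpha,\beta\rangle$. For $h\in GF(q)^*$ let $\mathcal{C}_h^*=\{(h\mu^2,\mu,1):\mu\in GF(q)^*\}$ (the conic $X_0X_2-hX_1^2=0$ minus $(0,0,1)$ and $(1,0,0)$). Then: (i) if $q\equiv-1\pmod 4$: (a) the $H_0$-orbits on $I$ of length $q-1$ are exactly the sets $\mathcal{C}_h^*$ with $h\in(1+Q_{+1})\cap Q_{+1}$; (b) the $H_1$-orbits on $I$ of length $q-1$ that are unions of two $H_0$-orbits of length $\frac{q-1}{2}$ are exactly the sets $\mathcal{C}_h^*$ with $h\in(1+Q_{+1})\cap Q_{ -1}$; (ii) if $q\equiv 1\pmod 4$: (a) the $H_0$-orbits on $I$ of length $q-1$ are exactly the sets $\mathcal{C}_h^*$ with $h\in(1+Q_{ -1})\cap Q_{ -1}$; (b) the $H_0$-orbits on $I$ of length $\frac{q-1}{2}$ are exactly $\mathcal{O}_\infty=\{(\mu,0,1):\mu\in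 Q_{ -1}\}$, $\mathcal{O}_{h,+1}=\{(h\mu^2,\mu,1):\mu\in Q_{+1}\}$ and $\mathcal{O}_{h,-1}=\{(h\mu^2,\mu,1):\mu\in Q_{ -1}\}$ for $h\in(1+Q_{ -1})\cap Q_{+1}$.
   Context: Points of $PG(2,q)$ are written in homogeneous coordinates $(X_0,X_1,X_2)$. For a set $A\subseteq GF(q)$, $1+A=\{1+a:a\in A\}$. $H_0$ is a dihedral group of order $q-1$ contained in the stabilizer $T\cong PSL(2,q)$ of $\mathcal{C}$ in $PGL(3,q)$, and both $H_0,H_1$ preserve $\mathcal{C}$ and $I$. -}

module Defs where

open import Level using (0ℓ)
open import Data.Nat as ℕ using (ℕ; zero; suc)
open import Data.Product using (Σ; ∃; ∃-syntax; _×_; _,_)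
open import Data.List using (List; length; _∷_; [])
open import Data.Sum using (_⊎_)
open import Function using (_∘_)
open import Data.List.Membership.Propositional using (_∈_)
open import Data.List.Relation.Unary.All using (All)
open import Data.List.Relation.Unary.Any using (Any)
open import Data.List.Relation.Unary.Unique.Propositional using (Unique)
open import Data.List.Relation.Unary.AllPairs using (AllPairs)
open import Relation.Binary.PropositionalEquality using (_≡_)
open import Relation.Binary.Definitions using (DecidableEquality)
open import Relation.Nullary using (¬_)
open import Algebra.Structures using (IsCommutativeRing)

record FiniteField : Set₁ where
  infixl 6 _+_ _-_
  infixl 7 _*_
  field
    F      : Set
    0# 1#  : F
    _+_ _*_ : F → F → F
    -_     : F → F
    _⁻¹    : F → F
    isCommutativeRing : IsCommutativeRing _≡_ _+_ _*_ -_ 0# 1#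
    0≢1    : ¬ (0# ≡ 1#)
    inverse : ∀ x → ¬ (x ≡ 0#) → x * (x ⁻¹) ≡ 1#
    _≟_    : DecidableEquality F
    elems  : List F
    elems-unique   : Unique elems
    elems-complete : ∀ x → x ∈ elems

  _-_ : F → F → F
  x - y = x + (- y)

  order : ℕ
  order = length elems

  pow : F → ℕ → F
  pow x zero    = 1#
  pow x (suc k) = x * pow x k

  NonZero : F → Set
  NonZero x = ¬ (x ≡ 0#)

  Primitive : F → Set
  Primitive ω = NonZero ω × (∀ x → NonZero x → ∃[ k ] pow ω k ≡ x)

  Qplus : F → Set
  Qplus x = NonZero x × ∃[ y ] y * y ≡ x

  Qminus : F → Set
  Qminus x = NonZero x × ¬ (∃[ y ] y * y ≡ x)

  -- membership in 1 + A  (i.e. h = 1 + a with a ∈ A, i.e. h - 1 ∈ A)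
  OnePlus : (F → Set) → F → Set
  OnePlus A h = A (h - 1#)

  -- The projective plane PG(2,q): points are nonzero triples up to
  -- nonzero scalars.  Sets of points are predicates on triples.
  Triple : Set
  Triple = F × F × F

  NonZeroT : Triple → Set
  NonZeroT (x₀ , x₁ , x₂) = ¬ (x₀ ≡ 0# × x₁ ≡ 0# × x₂ ≡ 0#)

  scale : F → Triple → Triple
  scale c (x₀ , x₁ , x₂) = (c * x₀ , c * x₁ , c * x₂)

  _∼_ : Triple → Triple → Set
  v ∼ w = ∃[ c ] NonZero c × v ≡ scale c w

  PointSet : Set₁
  PointSet = Triple → Set

  _≐_ : PointSet → PointSet → Set
  S ≐ T = ∀ v → NonZeroT v → (S v → T v) × (T v → S v)

  _∪_ : PointSet → PointSet → PointSet
  (S ∪ T) v = S v ⊎ T v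

  HasSize : PointSet → ℕ → Set
  HasSize S n = Σ (List Triple) λ L →
      length L ≡ n × All (λ v → NonZeroT v × S v) L
    × AllPairs (λ v w → ¬ (v ∼ w)) L
    × (∀ v → NonZeroT v → S v → Any (v ∼_) L)

  OnConic : Triple → Set
  OnConic (x₀ , x₁ , x₂) = x₀ * x₂ - x₁ * x₁ ≡ 0#

  -- lines are nonzero triples (a,b,c); incidence a X₀ + b X₁ + c X₂ = 0
  OnLine : Triple → Triple → Set
  OnLine (a , b , c) (x₀ , x₁ , x₂) = a * x₀ + b * x₁ + c * x₂ ≡ 0#

  Tangent : Triple → Set
  Tangent ℓ = NonZeroT ℓ × ∃[ P ] (NonZeroT P × OnConic P × OnLine ℓ P
              × (∀ Q → NonZeroT Q → OnConic Q → OnLine ℓ Q → Q ∼ P))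

  Internal : Triple → Set
  Internal P = NonZeroT P × (∀ ℓ → Tangent ℓ → ¬ OnLine ℓ P)

  -- A group is given by a list of generators (projectivities
  -- given by their action on coordinate vectors); the orbit of P is the set of
  -- points reachable from P by repeatedly applying generators.
  data Reach (gens : List (Triple → Triple)) (v : Triple) : Triple → Set where
    here : Reach gens v v
    step : ∀ {w} g → g ∈ gens → Reach gens v w → Reach gens v (g w)

  Orbit : List (Triple → Triple) → Triple → PointSet
  Orbit gens P Q = ∃[ w ] Reach gens P w × Q ∼ w

  IsOrbitOnIOfLength : List (Triple → Triple) → ℕ → PointSet → Set
  IsOrbitOnIOfLength gens n S =
    ∃[ P ] Internal P × HasSize (Orbit gens P) n × S ≐ Orbit gens P

  α : F → Triple → Triple
  α ω (x₀ , x₁ , x₂) = (ω * x₀ , x₁ , (ω ⁻¹) * x₂)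

  α⁻¹ : F → Triple → Triple
  α⁻¹ ω (x₀ , x₁ , x₂) = ((ω ⁻¹) * x₀ , x₁ , ω * x₂)

  β : Triple → Triple
  β (x₀ , x₁ , x₂) = (x₂ , - x₁ , x₀)

  -- generators of H₀ = ⟨α², β⟩ and H₁ = ⟨α, β⟩ (inverses included)
  H₀gens : F → List (Triple → Triple)
  H₀gens ω = (α ω ∘ α ω) ∷ (α⁻¹ ω ∘ α⁻¹ ω) ∷ β ∷ []

  H₁gens : F → List (Triple → Triple)
  H₁gens ω = α ω ∷ α⁻¹ ω ∷ β ∷ []

  Cstar : F → PointSet
  Cstar h v = ∃[ μ ] NonZero μ × v ∼ (h * (μ * μ) , μ , 1#)

  Oinf : PointSet
  Oinf v = ∃[ μ ] Qminus μ × v ∼ (μ , 0# , 1#)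

  Ohplus : F → PointSet
  Ohplus h v = ∃[ μ ] Qplus μ × v ∼ (h * (μ * μ) , μ , 1#)

  Ohminus : F → PointSet
  Ohminus h v = ∃[ μ ] Qminus μ × v ∼ (h * (μ * μ) , μ , 1#)

-- A point P is internal exactly when D(P) = x₁² − x₀x₂ is a non-square, so every internal point
-- is, up to scalars, Z c = (c, 0, 1) with −c a non-square or N h μ = (hμ², μ, 1) with 1 − h a
-- non-square. The generators act through the parameter: α multiplies μ by ω and c by ω², while
-- β sends μ to −(hμ)⁻¹ and c to c⁻¹. Hence H₁ is transitive on C*_h, and H₀, which only
-- multiplies μ by squares, is transitive on C*_h when β changes the square class of μ, that is
-- when −h is a non-square; otherwise its orbits there are O_{h,+1} and O_{h,−1}. On the points
-- Z c the whole of H₁ preserves the class of c, so these orbits have at most (q − 1)/2 points,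
-- and under H₀ the orbit of Z c with c a non-square is O_∞. Counting uses that the squares and
-- non-squares are the even and odd powers of ω, (q − 1)/2 of each, and q ≡ ±1 (mod 4) decides
-- whether −1 is a square, which turns the conditions on −h and 1 − h into those on h and h − 1.
module Submission where

open import Defs
open import Data.Nat using (ℕ; _^_; _<_; _∸_; _/_; _%_)
open import Data.Nat.Primality using (Prime)
open import Data.Product using (∃-syntax; _×_; _,_)
open import Data.Sum using (_⊎_)
open import Relation.Binary.PropositionalEquality using (_≡_)

open import Level using (0ℓ)
open import Function using (id; _∘_)
open import Data.Empty using (⊥; ⊥-elim)
open import Data.Product using (proj₁; proj₂; swap)
open import Data.Sum as Sum using (inj₁; inj₂; [_,_]′)
open import Data.Maybe using (Maybe; just; nothing)
open import Relation.Nullary using (Dec; yes; no; ¬_; _×-dec_; contradiction)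
open import Relation.Binary.Definitions using (tri<; tri≈; tri>)
open import Relation.Binary.PropositionalEquality
  using (_≢_; refl; sym; trans; cong; cong₂; subst; subst₂; module ≡-Reasoning)
open import Data.Nat as ℕ using (zero; suc; s≤s; z≤n)
import Data.Nat.Properties as ℕ
open import Data.Nat.DivMod using (m≡m%n+[m/n]*n; m%n<n; m*n/n≡m; %-distribˡ-*; [m+kn]%n≡m%n)
open import Data.Nat.Tactic.RingSolver using (solve-∀)
open import Data.Integer as ℤ using (ℤ; -[1+_])
import Data.Integer.Properties as ℤ
open import Data.Sign as Sign using (Sign)
open import Data.Fin as Fin using (Fin)
import Data.Fin.Properties as Fin
open import Data.List using (List; []; _∷_; length; lookup; applyUpTo)
open import Data.List.Properties using (length-applyUpTo)
open import Data.List.Membership.Propositional using (_∈_)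
open import Data.List.Membership.Propositional.Properties using (∈-lookup)
open import Data.List.Relation.Unary.Any as Any using (Any; here; there)
open import Data.List.Relation.Unary.Any.Properties using (lookup-index; applyUpTo⁺)
open import Data.List.Relation.Unary.All as All using (All; []; _∷_)
import Data.List.Relation.Unary.All.Properties as All
open import Data.List.Relation.Unary.AllPairs using (AllPairs; []; _∷_)
import Data.List.Relation.Unary.AllPairs.Properties as AllPairs
open import Algebra.Bundles using (CommutativeRing)
import Algebra.Properties.CommutativeSemigroup as CommutativeSemigroupProperties
import Algebra.Properties.Ring as RingProperties
import Algebra.Properties.Semiring.Mult.TCOptimised as SemiringMult
open import Algebra.Solver.Ring.AlmostCommutativeRing
  using (AlmostCommutativeRing; fromCommutativeRing; _-Raw-AlmostCommutative⟶_)

parity : ∀ e → ∃[ k ] (e ≡ k ℕ.+ k ⊎ e ≡ suc (k ℕ.+ k))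
parity zero    = 0 , inj₁ refl
parity (suc e) with parity e
... | k , inj₁ e≡k+k   = k , inj₂ (cong suc e≡k+k)
... | k , inj₂ e≡1+k+k = suc k , inj₁ (cong suc (trans e≡1+k+k (sym (ℕ.+-suc k k))))

k+k≢1+l+l : ∀ k l → k ℕ.+ k ≢ suc (l ℕ.+ l)
k+k≢1+l+l k l k+k≡1+l+l = ℕ.even≢odd k l (begin
  2 ℕ.* k                ≡⟨ cong (k ℕ.+_) (ℕ.+-identityʳ k) ⟩
  k ℕ.+ k                ≡⟨ k+k≡1+l+l ⟩
  suc (l ℕ.+ l)          ≡⟨ cong (λ z → suc (l ℕ.+ z)) (sym (ℕ.+-identityʳ l)) ⟩
  suc (2 ℕ.* l)          ∎)
  where open ≡-Reasoning

k+k<l+l⇒k<l : ∀ {k l} → k ℕ.+ k < l ℕ.+ l → k < l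
k+k<l+l⇒k<l {k} {l} k+k<l+l with k ℕ.<? l
... | yes k<l = k<l
... | no  k≮l = let l≤k = ℕ.≮⇒≥ k≮l in ⊥-elim (ℕ.<⇒≱ k+k<l+l (ℕ.+-mono-≤ l≤k l≤k))

k+k-injective : ∀ {k l} → k ℕ.+ k ≡ l ℕ.+ l → k ≡ l
k+k-injective {k} {l} k+k≡l+l with ℕ.<-cmp k l
... | tri< k<l _ _ = ⊥-elim (ℕ.<⇒≢ (ℕ.+-mono-< k<l k<l) k+k≡l+l)
... | tri≈ _ k≡l _ = k≡l
... | tri> _ _ l<k = ⊥-elim (ℕ.<⇒≢ (ℕ.+-mono-< l<k l<k) (sym k+k≡l+l))

odd-power : ∀ {p} f → p % 2 ≡ 1 → (p ^ f) % 2 ≡ 1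
odd-power zero    _ = refl
odd-power {p} (suc f) p-odd = begin
  (p ℕ.* p ^ f) % 2                 ≡⟨ %-distribˡ-* p (p ^ f) 2 ⟩
  ((p % 2) ℕ.* ((p ^ f) % 2)) % 2   ≡⟨ cong₂ (λ a b → (a ℕ.* b) % 2) p-odd (odd-power f p-odd) ⟩
  1                                 ∎
  where open ≡-Reasoning

odd⇒≡1+[m/2+m/2] : ∀ {m} → m % 2 ≡ 1 → m ≡ suc (m / 2 ℕ.+ m / 2)
odd⇒≡1+[m/2+m/2] {m} m-odd = begin
  m                          ≡⟨ m≡m%n+[m/n]*n m 2 ⟩
  m % 2 ℕ.+ (m / 2) ℕ.* 2    ≡⟨ cong₂ ℕ._+_ m-odd (x*2≡x+x (m / 2)) ⟩
  suc (m / 2 ℕ.+ m / 2)      ∎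
  where
  open ≡-Reasoning
  x*2≡x+x : ∀ x → x ℕ.* 2 ≡ x ℕ.+ x
  x*2≡x+x = solve-∀

5<1+2t⇒0<t : ∀ {t} → 5 < suc (t ℕ.+ t) → 0 < t
5<1+2t⇒0<t {zero}  (s≤s ())
5<1+2t⇒0<t {suc t} _ = s≤s z≤n

[1+2t]%4-by-parity : ∀ t → (suc (t ℕ.+ t) % 4 ≡ 1 × ∃[ s ] t ≡ s ℕ.+ s)
                         ⊎ (suc (t ℕ.+ t) % 4 ≡ 3 × ∃[ s ] t ≡ suc (s ℕ.+ s))
[1+2t]%4-by-parity t with parity t
... | s , inj₁ refl = inj₁ (trans (cong (_% 4) (4s+1 s)) ([m+kn]%n≡m%n 1 s 4) , s , refl)
  where
  4s+1 : ∀ s → suc ((s ℕ.+ s) ℕ.+ (s ℕ.+ s)) ≡ 1 ℕ.+ s ℕ.* 4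
  4s+1 = solve-∀
... | s , inj₂ refl = inj₂ (trans (cong (_% 4) (4s+3 s)) ([m+kn]%n≡m%n 3 s 4) , s , refl)
  where
  4s+3 : ∀ s → suc (suc (s ℕ.+ s) ℕ.+ suc (s ℕ.+ s)) ≡ 3 ℕ.+ s ℕ.* 4
  4s+3 = solve-∀

[1+2t]%4≡3⇒t-odd : ∀ {t} → suc (t ℕ.+ t) % 4 ≡ 3 → ∃[ s ] t ≡ suc (s ℕ.+ s)
[1+2t]%4≡3⇒t-odd {t} ≡3 with [1+2t]%4-by-parity t
... | inj₁ (≡1 , _) = contradiction (trans (sym ≡1) ≡3) λ ()
... | inj₂ (_ , odd) = odd

[1+2t]%4≡1⇒t-even : ∀ {t} → suc (t ℕ.+ t) % 4 ≡ 1 → ∃[ s ] t ≡ s ℕ.+ s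
[1+2t]%4≡1⇒t-even {t} ≡1 with [1+2t]%4-by-parity t
... | inj₁ (_ , even) = even
... | inj₂ (≡3 , _) = contradiction (trans (sym ≡3) ≡1) λ ()

module _ {A : Set} {_≈_ : A → A → Set} where

  lookup-apart : ∀ {xs} → AllPairs (λ x y → ¬ x ≈ y) xs → ∀ {i j} → i Fin.< j → ¬ lookup xs i ≈ lookup xs j
  lookup-apart (x≉ ∷ _)        {Fin.zero}  {Fin.suc j} _         = All.lookup x≉ (∈-lookup j)
  lookup-apart (_ ∷ distinct)  {Fin.suc i} {Fin.suc j} (s≤s i<j) = lookup-apart distinct i<j

  lookup-injective : (∀ {x y} → x ≈ y → y ≈ x) → ∀ {xs} → AllPairs (λ x y → ¬ x ≈ y) xs
    → ∀ {i j} → lookup xs i ≈ lookup xs j → i ≡ j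
  lookup-injective ≈-sym distinct {i} {j} xᵢ≈xⱼ with Fin.<-cmp i j
  ... | tri< i<j _ _ = ⊥-elim (lookup-apart distinct i<j xᵢ≈xⱼ)
  ... | tri≈ _ i≡j _ = i≡j
  ... | tri> _ _ j<i = ⊥-elim (lookup-apart distinct j<i (≈-sym xᵢ≈xⱼ))

-- The ring solver takes coefficients in ℤ, embedded by fromℤ: equality in F is decidable but
-- does not reduce on open terms, so F itself cannot serve as the coefficient ring.
module FieldSolver (K : FiniteField) where
  open FiniteField K

  commutativeRing : CommutativeRing 0ℓ 0ℓ
  commutativeRing = record { isCommutativeRing = isCommutativeRing }

  open CommutativeRing commutativeRing public
    using (+-comm; +-identityˡ; +-identityʳ; -‿inverseʳ; *-assoc; *-comm; *-identityˡ; *-identityʳ; zeroˡ; zeroʳ)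
  open RingProperties (CommutativeRing.ring commutativeRing) public
    using (-‿distribˡ-*; -‿distribʳ-*; -‿involutive; -‿+-comm; -0#≈0#; -1*x≈-x)
  open SemiringMult (CommutativeRing.semiring commutativeRing)
    renaming (_×_ to _×ᵣ_) using (×-homo-+; ×1-homo-*; 1+×)

  signed : Sign → F → F
  signed Sign.+ x = x
  signed Sign.- x = - x

  signed-* : ∀ s r x y → signed s x * signed r y ≡ signed (s Sign.* r) (x * y)
  signed-* Sign.+ Sign.+ x y = refl
  signed-* Sign.+ Sign.- x y = sym (-‿distribʳ-* x y)
  signed-* Sign.- Sign.+ x y = sym (-‿distribˡ-* x y)
  signed-* Sign.- Sign.- x y = begin
    - x * - y     ≡⟨ sym (-‿distribˡ-* x (- y)) ⟩
    - (x * - y)   ≡⟨ cong -_ (sym (-‿distribʳ-* x y)) ⟩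
    - - (x * y)   ≡⟨ -‿involutive (x * y) ⟩
    x * y         ∎
    where open ≡-Reasoning

  fromℤ : ℤ → F
  fromℤ (ℤ.+ n)   = n ×ᵣ 1#
  fromℤ -[1+ n ] = - (suc n ×ᵣ 1#)

  fromℤ-signAbs : ∀ i → fromℤ i ≡ signed (ℤ.sign i) (ℤ.∣ i ∣ ×ᵣ 1#)
  fromℤ-signAbs (ℤ.+ n)  = refl
  fromℤ-signAbs -[1+ n ] = refl

  fromℤ-◃ : ∀ s n → fromℤ (s ℤ.◃ n) ≡ signed s (n ×ᵣ 1#)
  fromℤ-◃ Sign.- zero    = sym -0#≈0#
  fromℤ-◃ Sign.+ zero    = refl
  fromℤ-◃ Sign.+ (suc n) = refl
  fromℤ-◃ Sign.- (suc n) = refl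

  1+x-[1+y]≡x-y : ∀ x y → (1# + x) - (1# + y) ≡ x - y
  1+x-[1+y]≡x-y x y = begin
    (1# + x) + - (1# + y)       ≡⟨ cong ((1# + x) +_) (sym (-‿+-comm 1# y)) ⟩
    (1# + x) + (- 1# + - y)     ≡⟨ +-interchange 1# x (- 1#) (- y) ⟩
    (1# + - 1#) + (x + - y)     ≡⟨ cong (_+ (x - y)) (-‿inverseʳ 1#) ⟩
    0# + (x - y)                ≡⟨ +-identityˡ (x - y) ⟩
    x - y                       ∎
    where
    open ≡-Reasoning
    open CommutativeSemigroupProperties (CommutativeRing.+-commutativeSemigroup commutativeRing)
      renaming (interchange to +-interchange)

  fromℤ-⊖ : ∀ m n → fromℤ (m ℤ.⊖ n) ≡ m ×ᵣ 1# - n ×ᵣ 1#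
  fromℤ-⊖ m       zero    = sym (trans (cong (m ×ᵣ 1# +_) -0#≈0#) (+-identityʳ _))
  fromℤ-⊖ zero    (suc n) = sym (+-identityˡ _)
  fromℤ-⊖ (suc m) (suc n) = begin
    fromℤ (suc m ℤ.⊖ suc n)                  ≡⟨ cong fromℤ (ℤ.[1+m]⊖[1+n]≡m⊖n m n) ⟩
    fromℤ (m ℤ.⊖ n)                          ≡⟨ fromℤ-⊖ m n ⟩
    m ×ᵣ 1# - n ×ᵣ 1#                          ≡⟨ sym (1+x-[1+y]≡x-y (m ×ᵣ 1#) (n ×ᵣ 1#)) ⟩
    (1# + m ×ᵣ 1#) - (1# + n ×ᵣ 1#)            ≡⟨ sym (cong₂ _-_ (1+× m 1#) (1+× n 1#)) ⟩
    suc m ×ᵣ 1# - suc n ×ᵣ 1#                  ∎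
    where open ≡-Reasoning

  fromℤ-+ : ∀ i j → fromℤ (i ℤ.+ j) ≡ fromℤ i + fromℤ j
  fromℤ-+ -[1+ m ] -[1+ n ] = begin
    - (suc (suc (m ℕ.+ n)) ×ᵣ 1#)          ≡⟨ cong (λ k → - (suc k ×ᵣ 1#)) (sym (ℕ.+-suc m n)) ⟩
    - ((suc m ℕ.+ suc n) ×ᵣ 1#)            ≡⟨ cong -_ (×-homo-+ 1# (suc m) (suc n)) ⟩
    - (suc m ×ᵣ 1# + suc n ×ᵣ 1#)           ≡⟨ sym (-‿+-comm _ _) ⟩
    - (suc m ×ᵣ 1#) + - (suc n ×ᵣ 1#)       ∎
    where open ≡-Reasoning
  fromℤ-+ -[1+ m ] (ℤ.+ n)  = trans (fromℤ-⊖ n (suc m)) (+-comm _ _)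
  fromℤ-+ (ℤ.+ m)  -[1+ n ] = fromℤ-⊖ m (suc n)
  fromℤ-+ (ℤ.+ m)  (ℤ.+ n)  = ×-homo-+ 1# m n

  fromℤ-* : ∀ i j → fromℤ (i ℤ.* j) ≡ fromℤ i * fromℤ j
  fromℤ-* i j = begin
    fromℤ (i ℤ.* j)                                  ≡⟨ fromℤ-◃ (s Sign.* r) (∣i∣ ℕ.* ∣j∣) ⟩
    signed (s Sign.* r) ((∣i∣ ℕ.* ∣j∣) ×ᵣ 1#)         ≡⟨ cong (signed (s Sign.* r)) (×1-homo-* ∣i∣ ∣j∣) ⟩
    signed (s Sign.* r) ((∣i∣ ×ᵣ 1#) * (∣j∣ ×ᵣ 1#))    ≡⟨ sym (signed-* s r _ _) ⟩
    signed s (∣i∣ ×ᵣ 1#) * signed r (∣j∣ ×ᵣ 1#)        ≡⟨ sym (cong₂ _*_ (fromℤ-signAbs i) (fromℤ-signAbs j)) ⟩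
    fromℤ i * fromℤ j                                ∎
    where
    open ≡-Reasoning
    s = ℤ.sign i
    r = ℤ.sign j
    ∣i∣ = ℤ.∣ i ∣
    ∣j∣ = ℤ.∣ j ∣

  fromℤ-‿ : ∀ i → fromℤ (ℤ.- i) ≡ - fromℤ i
  fromℤ-‿ -[1+ n ]         = sym (-‿involutive _)
  fromℤ-‿ (ℤ.+ zero)       = sym -0#≈0#
  fromℤ-‿ (ℤ.+ suc n)      = refl

  fromℤ-morphism : ℤ.+-*-rawRing -Raw-AlmostCommutative⟶ fromCommutativeRing commutativeRing
  fromℤ-morphism = record
    { ⟦_⟧ = fromℤ ; +-homo = fromℤ-+ ; *-homo = fromℤ-* ; -‿homo = fromℤ-‿
    ; 0-homo = refl ; 1-homo = refl }

  fromℤ-≟ : ∀ i j → Maybe (fromℤ i ≡ fromℤ j)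
  fromℤ-≟ i j with i ℤ.≟ j
  ... | yes refl = just refl
  ... | no _     = nothing

  open import Algebra.Solver.Ring ℤ.+-*-rawRing (fromCommutativeRing commutativeRing) fromℤ-morphism fromℤ-≟
    public using (solve; _:=_; _:+_; _:*_; _:-_; :-_; con; Polynomial)

  :0 :1 : ∀ {k} → Polynomial k
  :0 = con (ℤ.+ 0)
  :1 = con (ℤ.+ 1)

module FieldProperties (K : FiniteField) where
  open FiniteField K
  open FieldSolver K

  1#≢0# : NonZero 1#
  1#≢0# 1≡0 = 0≢1 (sym 1≡0)

  inverseˡ : ∀ x → NonZero x → x ⁻¹ * x ≡ 1#
  inverseˡ x x≢0 = trans (*-comm _ _) (inverse x x≢0)

  *-cancelˡ : ∀ a {x y} → NonZero a → a * x ≡ a * y → x ≡ y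
  *-cancelˡ a {x} {y} a≢0 ax≡ay = begin
    x                ≡⟨ sym (*-identityˡ x) ⟩
    1# * x           ≡⟨ cong (_* x) (sym (inverseˡ a a≢0)) ⟩
    (a ⁻¹ * a) * x   ≡⟨ *-assoc _ _ _ ⟩
    a ⁻¹ * (a * x)   ≡⟨ cong (a ⁻¹ *_) ax≡ay ⟩
    a ⁻¹ * (a * y)   ≡⟨ sym (*-assoc _ _ _) ⟩
    (a ⁻¹ * a) * y   ≡⟨ cong (_* y) (inverseˡ a a≢0) ⟩
    1# * y           ≡⟨ *-identityˡ y ⟩
    y                ∎
    where open ≡-Reasoning

  x*y≡0⇒x≡0∨y≡0 : ∀ x y → x * y ≡ 0# → x ≡ 0# ⊎ y ≡ 0#
  x*y≡0⇒x≡0∨y≡0 x y xy≡0 with x ≟ 0#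
  ... | yes x≡0 = inj₁ x≡0
  ... | no  x≢0 = inj₂ (*-cancelˡ x x≢0 (trans xy≡0 (sym (zeroʳ x))))

  *-nonZero : ∀ {x y} → NonZero x → NonZero y → NonZero (x * y)
  *-nonZero {x} {y} x≢0 y≢0 xy≡0 = [ x≢0 , y≢0 ]′ (x*y≡0⇒x≡0∨y≡0 x y xy≡0)

  ⁻¹-nonZero : ∀ {x} → NonZero x → NonZero (x ⁻¹)
  ⁻¹-nonZero {x} x≢0 x⁻¹≡0 =
    1#≢0# (trans (sym (inverse x x≢0)) (trans (cong (x *_) x⁻¹≡0) (zeroʳ x)))

  -x≡0⇒x≡0 : ∀ {x} → - x ≡ 0# → x ≡ 0#
  -x≡0⇒x≡0 {x} -x≡0 = trans (sym (-‿involutive x)) (trans (cong -_ -x≡0) -0#≈0#)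

  -‿nonZero : ∀ {x} → NonZero x → NonZero (- x)
  -‿nonZero x≢0 = x≢0 ∘ -x≡0⇒x≡0

  -x≢0⇒x≢0 : ∀ {x} → NonZero (- x) → NonZero x
  -x≢0⇒x≢0 -x≢0 x≡0 = -x≢0 (trans (cong -_ x≡0) -0#≈0#)

  x*x≡0⇒x≡0 : ∀ {x} → x * x ≡ 0# → x ≡ 0#
  x*x≡0⇒x≡0 {x} xx≡0 = [ id , id ]′ (x*y≡0⇒x≡0∨y≡0 x x xx≡0)

  x-y≡0⇒x≡y : ∀ {x y} → x - y ≡ 0# → x ≡ y
  x-y≡0⇒x≡y {x} {y} x-y≡0 = begin
    x              ≡⟨ solve 2 (λ x y → x := (x :- y) :+ y) refl x y ⟩
    (x - y) + y    ≡⟨ cong (_+ y) x-y≡0 ⟩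
    0# + y         ≡⟨ +-identityˡ y ⟩
    y              ∎
    where open ≡-Reasoning

  x*x≡1⇒x≡1∨x≡-1 : ∀ {x} → x * x ≡ 1# → x ≡ 1# ⊎ x ≡ - 1#
  x*x≡1⇒x≡1∨x≡-1 {x} xx≡1 with x*y≡0⇒x≡0∨y≡0 (x - 1#) (x + 1#) [x-1][x+1]≡0
    where
    [x-1][x+1]≡0 : (x - 1#) * (x + 1#) ≡ 0#
    [x-1][x+1]≡0 = begin
      (x - 1#) * (x + 1#)  ≡⟨ solve 1 (λ x → (x :- :1) :* (x :+ :1) := x :* x :- :1) refl x ⟩
      x * x - 1#           ≡⟨ cong (_- 1#) xx≡1 ⟩
      1# - 1#              ≡⟨ -‿inverseʳ 1# ⟩
      0#                   ∎
      where open ≡-Reasoning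
  ... | inj₁ x-1≡0 = inj₁ (x-y≡0⇒x≡y x-1≡0)
  ... | inj₂ x+1≡0 = inj₂ (x-y≡0⇒x≡y (trans (cong (x +_) (-‿involutive 1#)) x+1≡0))

  pow-+ : ∀ x a b → pow x (a ℕ.+ b) ≡ pow x a * pow x b
  pow-+ x zero    b = sym (*-identityˡ _)
  pow-+ x (suc a) b = trans (cong (x *_) (pow-+ x a b)) (sym (*-assoc _ _ _))

  pow-nonZero : ∀ {x} k → NonZero x → NonZero (pow x k)
  pow-nonZero zero    x≢0 = 1#≢0#
  pow-nonZero (suc k) x≢0 = *-nonZero x≢0 (pow-nonZero k x≢0)

  pow-*-distrib : ∀ x y k → pow (x * y) k ≡ pow x k * pow y k
  pow-*-distrib x y zero    = sym (*-identityˡ 1#)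
  pow-*-distrib x y (suc k) = trans (cong ((x * y) *_) (pow-*-distrib x y k))
    (solve 4 (λ x y a b → (x :* y) :* (a :* b) := (x :* a) :* (y :* b)) refl x y (pow x k) (pow y k))

  pow-periodic : ∀ {x d} → pow x d ≡ 1# → ∀ r m → pow x (r ℕ.+ m ℕ.* d) ≡ pow x r
  pow-periodic {x} {d} xᵈ≡1 r zero    = cong (pow x) (ℕ.+-identityʳ r)
  pow-periodic {x} {d} xᵈ≡1 r (suc m) = begin
    pow x (r ℕ.+ (d ℕ.+ m ℕ.* d))       ≡⟨ cong (pow x) (x∙yz≈y∙xz r d (m ℕ.* d)) ⟩
    pow x (d ℕ.+ (r ℕ.+ m ℕ.* d))       ≡⟨ pow-+ x d _ ⟩
    pow x d * pow x (r ℕ.+ m ℕ.* d)     ≡⟨ cong₂ _*_ xᵈ≡1 (pow-periodic xᵈ≡1 r m) ⟩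
    1# * pow x r                        ≡⟨ *-identityˡ _ ⟩
    pow x r                             ∎
    where
    open ≡-Reasoning
    open CommutativeSemigroupProperties ℕ.+-commutativeSemigroup using (x∙yz≈y∙xz)

  IsSquare : F → Set
  IsSquare x = ∃[ y ] y * y ≡ x

  isSquare? : ∀ x → Dec (IsSquare x)
  isSquare? x with Any.any? (λ y → (y * y) ≟ x) elems
  ... | yes y*y≡x = yes (Any.satisfied y*y≡x)
  ... | no  none  = no λ (y , y*y≡x) → none (Any.map (λ { refl → y*y≡x }) (elems-complete y))

  Qplus⊎Qminus : ∀ {x} → NonZero x → Qplus x ⊎ Qminus x
  Qplus⊎Qminus {x} x≢0 with isSquare? x
  ... | yes □ = inj₁ (x≢0 , □)
  ... | no ¬□ = inj₂ (x≢0 , ¬□)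

  Qplus∧Qminus⇒⊥ : ∀ {x} → Qplus x → Qminus x → ⊥
  Qplus∧Qminus⇒⊥ (_ , □) (_ , ¬□) = ¬□ □

  x*y⁻¹*y≡x : ∀ x {y} → NonZero y → x * y ⁻¹ * y ≡ x
  x*y⁻¹*y≡x x {y} y≢0 = trans (*-assoc _ _ _) (trans (cong (x *_) (inverseˡ y y≢0)) (*-identityʳ x))

  square-root-nonZero : ∀ {x y} → NonZero x → y * y ≡ x → NonZero y
  square-root-nonZero {x} {y} x≢0 y²≡x y≡0 = x≢0 (trans (sym y²≡x) (trans (cong (_* y) y≡0) (zeroˡ y)))

  Qplus-square : ∀ {y} → NonZero y → Qplus (y * y)
  Qplus-square y≢0 = *-nonZero y≢0 y≢0 , _ , refl

  Qplus-1# : Qplus 1#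
  Qplus-1# = 1#≢0# , 1# , *-identityˡ 1#

  a*a*d≡c*c⇒IsSquare : ∀ {a c d} → NonZero a → a * a * d ≡ c * c → IsSquare d
  a*a*d≡c*c⇒IsSquare {a} {c} {d} a≢0 a²d≡c² = c * a ⁻¹ , *-cancelˡ (a * a) (*-nonZero a≢0 a≢0) (begin
    a * a * ((c * a ⁻¹) * (c * a ⁻¹))   ≡⟨ solve 3 (λ a a⁻¹ c → a :* a :* ((c :* a⁻¹) :* (c :* a⁻¹))
                                                  := (a :* a⁻¹) :* (a :* a⁻¹) :* (c :* c)) refl a (a ⁻¹) c ⟩
    (a * a ⁻¹) * (a * a ⁻¹) * (c * c)   ≡⟨ cong (λ z → z * z * (c * c)) (inverse a a≢0) ⟩
    1# * 1# * (c * c)                   ≡⟨ solve 1 (λ c → :1 :* :1 :* (c :* c) := c :* c) refl c ⟩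
    c * c                               ≡⟨ sym a²d≡c² ⟩
    a * a * d                           ∎)
    where open ≡-Reasoning

  Qplus-* : ∀ {a b} → Qplus a → Qplus b → Qplus (a * b)
  Qplus-* {a} {b} (a≢0 , y , y²≡a) (b≢0 , z , z²≡b) = *-nonZero a≢0 b≢0 , y * z , (begin
    (y * z) * (y * z)   ≡⟨ solve 2 (λ y z → (y :* z) :* (y :* z) := (y :* y) :* (z :* z)) refl y z ⟩
    (y * y) * (z * z)   ≡⟨ cong₂ _*_ y²≡a z²≡b ⟩
    a * b               ∎)
    where open ≡-Reasoning

  Qplus-*-Qminus : ∀ {a b} → Qplus a → Qminus b → Qminus (a * b)
  Qplus-*-Qminus {a} {b} (a≢0 , y , y²≡a) (b≢0 , ¬□b) = *-nonZero a≢0 b≢0 , λ (w , w²≡ab) →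
    ¬□b (a*a*d≡c*c⇒IsSquare (square-root-nonZero a≢0 y²≡a) (trans (cong (_* b) y²≡a) (sym w²≡ab)))

  Qminus-*-Qplus : ∀ {a b} → Qminus a → Qplus b → Qminus (a * b)
  Qminus-*-Qplus qa qb = subst Qminus (*-comm _ _) (Qplus-*-Qminus qb qa)

  Qplus-*-cancelˡ : ∀ {a b} → Qplus a → Qminus (a * b) → Qminus b
  Qplus-*-cancelˡ {a} {b} qa qab with b ≟ 0#
  ... | yes b≡0 = ⊥-elim (proj₁ qab (trans (cong (a *_) b≡0) (zeroʳ a)))
  ... | no  b≢0 with Qplus⊎Qminus b≢0
  ...   | inj₁ qb = ⊥-elim (Qplus∧Qminus⇒⊥ (Qplus-* qa qb) qab)
  ...   | inj₂ qb = qb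


module Projective (K : FiniteField) where
  open FiniteField K
  open FieldSolver K
  open FieldProperties K

  scale-1# : ∀ v → scale 1# v ≡ v
  scale-1# (a , b , c) = cong₂ _,_ (*-identityˡ a) (cong₂ _,_ (*-identityˡ b) (*-identityˡ c))

  scale-* : ∀ c d v → scale c (scale d v) ≡ scale (c * d) v
  scale-* c d (a , b , e) = sym (cong₂ _,_ (*-assoc c d a) (cong₂ _,_ (*-assoc c d b) (*-assoc c d e)))

  ∼-refl : ∀ {v} → v ∼ v
  ∼-refl {v} = 1# , 1#≢0# , sym (scale-1# v)

  ∼-reflexive : ∀ {v w} → v ≡ w → v ∼ w
  ∼-reflexive refl = ∼-refl

  ∼-sym : ∀ {v w} → v ∼ w → w ∼ v
  ∼-sym {v} {w} (c , c≢0 , refl) = c ⁻¹ , ⁻¹-nonZero c≢0 , (begin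
    w                         ≡⟨ sym (scale-1# w) ⟩
    scale 1# w                ≡⟨ cong (λ z → scale z w) (sym (inverseˡ c c≢0)) ⟩
    scale (c ⁻¹ * c) w        ≡⟨ sym (scale-* (c ⁻¹) c w) ⟩
    scale (c ⁻¹) (scale c w)  ∎)
    where open ≡-Reasoning

  ∼-trans : ∀ {u v w} → u ∼ v → v ∼ w → u ∼ w
  ∼-trans {w = w} (c , c≢0 , refl) (d , d≢0 , refl) = c * d , *-nonZero c≢0 d≢0 , scale-* c d w

  affine-nonZero : ∀ a b → NonZeroT (a , b , 1#)
  affine-nonZero a b (_ , _ , 1≡0) = 1#≢0# 1≡0

  affine-∼-injective : ∀ {a b a′ b′} → (a , b , 1#) ∼ (a′ , b′ , 1#) → a ≡ a′ × b ≡ b′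
  affine-∼-injective {a′ = a′} {b′} (c , _ , v≡cw) =
    trans (cong proj₁ v≡cw) (c*x≡x a′) , trans (cong (proj₁ ∘ proj₂) v≡cw) (c*x≡x b′)
    where
    c≡1 : c ≡ 1#
    c≡1 = trans (sym (*-identityʳ c)) (sym (cong (proj₂ ∘ proj₂) v≡cw))
    c*x≡x : ∀ x → c * x ≡ x
    c*x≡x x = trans (cong (_* x) c≡1) (*-identityˡ x)

  infix 4 _⊆ₚ_
  _⊆ₚ_ : PointSet → PointSet → Set
  S ⊆ₚ T = ∀ v → NonZeroT v → S v → T v

  ≐-sym : ∀ {S T} → S ≐ T → T ≐ S
  ≐-sym S≐T v v≢0 = swap (S≐T v v≢0)

  ≐-trans : ∀ {S T U} → S ≐ T → T ≐ U → S ≐ U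
  ≐-trans S≐T T≐U v v≢0 =
    proj₁ (T≐U v v≢0) ∘ proj₁ (S≐T v v≢0) , proj₂ (S≐T v v≢0) ∘ proj₂ (T≐U v v≢0)

  ≐⇒⊆ : ∀ {S T} → S ≐ T → S ⊆ₚ T
  ≐⇒⊆ S≐T v v≢0 = proj₁ (S≐T v v≢0)

  ⊆-antisym : ∀ {S T} → S ⊆ₚ T → T ⊆ₚ S → S ≐ T
  ⊆-antisym S⊆T T⊆S v v≢0 = S⊆T v v≢0 , T⊆S v v≢0

  Image : (F → Triple) → (F → Set) → PointSet
  Image form S v = ∃[ μ ] S μ × v ∼ form μ

  HasSize-≐ : ∀ {S T k} → S ≐ T → HasSize S k → HasSize T k
  HasSize-≐ S≐T (L , length≡k , L⊆S , distinct , covers) =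
    L , length≡k , All.map (λ (v≢0 , Sv) → v≢0 , proj₁ (S≐T _ v≢0) Sv) L⊆S , distinct ,
    λ v v≢0 Tv → covers v v≢0 (proj₂ (S≐T v v≢0) Tv)

  HasSize-mono : ∀ {S T a b} → HasSize S a → S ⊆ₚ T → HasSize T b → a ℕ.≤ b
  HasSize-mono {S} (L , refl , L⊆S , distinct , _) S⊆T (M , refl , _ , _ , M-covers) =
    Fin.injective⇒≤ {f = slot} λ {i} {j} same-slot →
      lookup-injective ∼-sym distinct (∼-trans (lookup-index (cover i))
        (∼-sym (subst (λ k → lookup L j ∼ lookup M k) (sym same-slot) (lookup-index (cover j)))))
    where
    member : ∀ i → NonZeroT (lookup L i) × S (lookup L i)
    member i = All.lookup L⊆S (∈-lookup i)
    cover : ∀ i → Any (lookup L i ∼_) M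
    cover i = let (v≢0 , Sv) = member i in M-covers _ v≢0 (S⊆T _ v≢0 Sv)
    slot : Fin (length L) → Fin (length M)
    slot i = Any.index (cover i)

  HasSize-Image : ∀ {form : F → Triple} {S : F → Set} (enum : ℕ → F) m
    → (∀ {μ ν} → form μ ∼ form ν → μ ≡ ν) → (∀ μ → NonZeroT (form μ))
    → (∀ {k} → k < m → S (enum k))
    → (∀ {i j} → i < m → j < m → enum i ≡ enum j → i ≡ j)
    → (∀ {μ} → S μ → ∃[ k ] k < m × enum k ≡ μ)
    → HasSize (Image form S) m
  HasSize-Image {form} enum m form-injective form≢0 enum∈S enum-injective enum-onto =
    applyUpTo (form ∘ enum) m , length-applyUpTo _ m ,
    All.applyUpTo⁺₁ _ m (λ k<m → form≢0 _ , _ , enum∈S k<m , ∼-refl) ,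
    AllPairs.applyUpTo⁺₁ _ m (λ i<j j<m →
      ℕ.<⇒≢ i<j ∘ enum-injective (ℕ.<-trans i<j j<m) j<m ∘ form-injective) ,
    λ v _ (μ , Sμ , v∼formμ) → let (k , k<m , enumₖ≡μ) = enum-onto Sμ in
      applyUpTo⁺ _ (subst (λ z → v ∼ form z) (sym enumₖ≡μ) v∼formμ) k<m

module Conic (K : FiniteField) where
  open FiniteField K
  open FieldSolver K
  open FieldProperties K
  open Projective K

  D : Triple → F
  D (x₀ , x₁ , x₂) = x₁ * x₁ - x₀ * x₂

  D-scale : ∀ c v → D (scale c v) ≡ (c * c) * D v
  D-scale c (x₀ , x₁ , x₂) = solve 4 (λ c x₀ x₁ x₂ →
    (c :* x₁) :* (c :* x₁) :- (c :* x₀) :* (c :* x₂) := (c :* c) :* (x₁ :* x₁ :- x₀ :* x₂)) refl c x₀ x₁ x₂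

  tangent-X₂ : Tangent (0# , 0# , 1#)
  tangent-X₂ = (λ (_ , _ , 1≡0) → 1#≢0# 1≡0) , (1# , 0# , 0#) , (λ (1≡0 , _) → 1#≢0# 1≡0)
    , solve 0 (:1 :* :0 :- :0 :* :0 := :0) refl , solve 0 (:0 :* :1 :+ :0 :* :0 :+ :1 :* :0 := :0) refl
    , unique
    where
    unique : ∀ Q → NonZeroT Q → OnConic Q → OnLine (0# , 0# , 1#) Q → Q ∼ (1# , 0# , 0#)
    unique (q₀ , q₁ , q₂) Q≢0 Q∈C Q∈ℓ = q₀ , q₀≢0 , cong₂ _,_ (sym (*-identityʳ q₀))
      (cong₂ _,_ (trans q₁≡0 (sym (zeroʳ q₀))) (trans q₂≡0 (sym (zeroʳ q₀))))
      where
      q₂≡0 : q₂ ≡ 0#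
      q₂≡0 = trans (solve 3 (λ q₀ q₁ q₂ → q₂ := :0 :* q₀ :+ :0 :* q₁ :+ :1 :* q₂) refl q₀ q₁ q₂) Q∈ℓ
      q₁≡0 : q₁ ≡ 0#
      q₁≡0 = x*x≡0⇒x≡0 (-x≡0⇒x≡0 (begin
        - (q₁ * q₁)              ≡⟨ solve 2 (λ q₀ q₁ → :- (q₁ :* q₁) := q₀ :* :0 :- q₁ :* q₁) refl q₀ q₁ ⟩
        q₀ * 0# - q₁ * q₁        ≡⟨ cong (λ z → q₀ * z - q₁ * q₁) (sym q₂≡0) ⟩
        q₀ * q₂ - q₁ * q₁        ≡⟨ Q∈C ⟩
        0#                       ∎))
        where open ≡-Reasoning
      q₀≢0 : NonZero q₀
      q₀≢0 q₀≡0 = Q≢0 (q₀≡0 , q₁≡0 , q₂≡0)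

  tangent-affine : ∀ s → Tangent (1# , - (s + s) , s * s)
  tangent-affine s = (λ (1≡0 , _) → 1#≢0# 1≡0) , (s * s , s , 1#) , affine-nonZero (s * s) s
    , solve 1 (λ s → (s :* s) :* :1 :- s :* s := :0) refl s
    , solve 1 (λ s → :1 :* (s :* s) :+ (:- (s :+ s)) :* s :+ (s :* s) :* :1 := :0) refl s
    , unique
    where
    unique : ∀ Q → NonZeroT Q → OnConic Q → OnLine (1# , - (s + s) , s * s) Q → Q ∼ (s * s , s , 1#)
    unique (q₀ , q₁ , q₂) Q≢0 Q∈C Q∈ℓ = q₂ , q₂≢0 , cong₂ _,_ q₀≡q₂s² (cong₂ _,_ q₁≡q₂s (sym (*-identityʳ q₂)))
      where
      open ≡-Reasoning
      L = 1# * q₀ + (- (s + s)) * q₁ + (s * s) * q₂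
      q₁-sq₂≡0 : q₁ - s * q₂ ≡ 0#
      q₁-sq₂≡0 = x*x≡0⇒x≡0 (begin
        (q₁ - s * q₂) * (q₁ - s * q₂)   ≡⟨ solve 4 (λ s q₀ q₁ q₂ → (q₁ :- s :* q₂) :* (q₁ :- s :* q₂)
             := q₂ :* (:1 :* q₀ :+ (:- (s :+ s)) :* q₁ :+ (s :* s) :* q₂) :- (q₀ :* q₂ :- q₁ :* q₁)) refl s q₀ q₁ q₂ ⟩
        q₂ * L - (q₀ * q₂ - q₁ * q₁)   ≡⟨ cong₂ (λ l c → q₂ * l - c) Q∈ℓ Q∈C ⟩
        q₂ * 0# - 0#                   ≡⟨ solve 1 (λ q₂ → q₂ :* :0 :- :0 := :0) refl q₂ ⟩
        0#                             ∎)
      q₁≡q₂s : q₁ ≡ q₂ * s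
      q₁≡q₂s = trans (x-y≡0⇒x≡y q₁-sq₂≡0) (*-comm s q₂)
      q₀≡q₂s² : q₀ ≡ q₂ * (s * s)
      q₀≡q₂s² = begin
        q₀                                                ≡⟨ solve 4 (λ s q₀ q₁ q₂ → q₀
             := (:1 :* q₀ :+ (:- (s :+ s)) :* q₁ :+ (s :* s) :* q₂) :+ (s :+ s) :* (q₁ :- s :* q₂) :+ q₂ :* (s :* s))
             refl s q₀ q₁ q₂ ⟩
        L + (s + s) * (q₁ - s * q₂) + q₂ * (s * s)        ≡⟨ cong₂ (λ l d → l + (s + s) * d + q₂ * (s * s)) Q∈ℓ q₁-sq₂≡0 ⟩
        0# + (s + s) * 0# + q₂ * (s * s)                  ≡⟨ solve 2 (λ s x → :0 :+ (s :+ s) :* :0 :+ x := x) refl s (q₂ * (s * s)) ⟩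
        q₂ * (s * s)                                      ∎
      q₂≢0 : NonZero q₂
      q₂≢0 q₂≡0 = Q≢0 (trans q₀≡q₂s² (trans (cong (_* (s * s)) q₂≡0) (zeroˡ _))
                     , trans q₁≡q₂s (trans (cong (_* s) q₂≡0) (zeroˡ s)) , q₂≡0)

  -- If D(P) = y², then P lies on X₂ = 0 (when x₂ = 0) or on the tangent at (s², s, 1) with s = (x₁ + y)/x₂.
  IsSquare-D⇒on-tangent : ∀ P → IsSquare (D P) → ∃[ ℓ ] Tangent ℓ × OnLine ℓ P
  IsSquare-D⇒on-tangent (x₀ , x₁ , x₂) (y , y²≡D) with x₂ ≟ 0#
  ... | yes x₂≡0 = _ , tangent-X₂ ,
    trans (solve 3 (λ x₀ x₁ x₂ → :0 :* x₀ :+ :0 :* x₁ :+ :1 :* x₂ := x₂) refl x₀ x₁ x₂) x₂≡0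
  ... | no x₂≢0 = _ , tangent-affine s , *-cancelˡ x₂ x₂≢0 (begin
    x₂ * (1# * x₀ + (- (s + s)) * x₁ + (s * s) * x₂)
      ≡⟨ solve 4 (λ s x₀ x₁ x₂ → x₂ :* (:1 :* x₀ :+ (:- (s :+ s)) :* x₁ :+ (s :* s) :* x₂)
                   := x₂ :* x₀ :- ((s :* x₂) :+ (s :* x₂)) :* x₁ :+ (s :* x₂) :* (s :* x₂)) refl s x₀ x₁ x₂ ⟩
    x₂ * x₀ - (s * x₂ + s * x₂) * x₁ + (s * x₂) * (s * x₂)
      ≡⟨ cong (λ w → x₂ * x₀ - (w + w) * x₁ + w * w) sx₂≡x₁+y ⟩
    x₂ * x₀ - ((x₁ + y) + (x₁ + y)) * x₁ + (x₁ + y) * (x₁ + y)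
      ≡⟨ solve 4 (λ x₀ x₁ x₂ y → x₂ :* x₀ :- ((x₁ :+ y) :+ (x₁ :+ y)) :* x₁ :+ (x₁ :+ y) :* (x₁ :+ y)
                   := y :* y :- (x₁ :* x₁ :- x₀ :* x₂)) refl x₀ x₁ x₂ y ⟩
    y * y - (x₁ * x₁ - x₀ * x₂)
      ≡⟨ trans (cong (_- (x₁ * x₁ - x₀ * x₂)) y²≡D) (-‿inverseʳ _) ⟩
    0#
      ≡⟨ sym (zeroʳ x₂) ⟩
    x₂ * 0# ∎)
    where
    open ≡-Reasoning
    s = (x₁ + y) * x₂ ⁻¹
    sx₂≡x₁+y : s * x₂ ≡ x₁ + y
    sx₂≡x₁+y = x*y⁻¹*y≡x (x₁ + y) x₂≢0

  internal⇒Qminus-D : ∀ {P} → Internal P → Qminus (D P)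
  internal⇒Qminus-D {P} (_ , off-tangents) with isSquare? (D P)
  ... | yes □ = let (ℓ , ℓ-tangent , P∈ℓ) = IsSquare-D⇒on-tangent P □ in ⊥-elim (off-tangents ℓ ℓ-tangent P∈ℓ)
  ... | no ¬□ = (λ D≡0 → ¬□ (0# , trans (zeroˡ 0#) (sym D≡0))) , ¬□

  conicForm : Triple → F
  conicForm (x₀ , x₁ , x₂) = x₀ * x₂ - x₁ * x₁

  polar : Triple → Triple → F
  polar (t₀ , t₁ , t₂) (x₀ , x₁ , x₂) = t₂ * x₀ + (- (t₁ + t₁)) * x₁ + t₀ * x₂

  combine : F → Triple → F → Triple → Triple
  combine a (t₀ , t₁ , t₂) b (x₀ , x₁ , x₂) = (a * t₀ - b * x₀ , a * t₁ - b * x₁ , a * t₂ - b * x₂)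

  D≡-conicForm : ∀ v → D v ≡ - conicForm v
  D≡-conicForm (x₀ , x₁ , x₂) = solve 3 (λ x₀ x₁ x₂ → x₁ :* x₁ :- x₀ :* x₂ := :- (x₀ :* x₂ :- x₁ :* x₁)) refl x₀ x₁ x₂

  conicForm-scale : ∀ c v → conicForm (scale c v) ≡ c * c * conicForm v
  conicForm-scale c (x₀ , x₁ , x₂) = solve 4 (λ c x₀ x₁ x₂ →
    (c :* x₀) :* (c :* x₂) :- (c :* x₁) :* (c :* x₁) := c :* c :* (x₀ :* x₂ :- x₁ :* x₁)) refl c x₀ x₁ x₂

  conicForm-combine : ∀ a T b P → conicForm (combine a T b P) ≡ a * a * conicForm T - a * b * polar T P + b * b * conicForm P
  conicForm-combine a (t₀ , t₁ , t₂) b (x₀ , x₁ , x₂) = solve 8 (λ a t₀ t₁ t₂ b x₀ x₁ x₂ →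
    (a :* t₀ :- b :* x₀) :* (a :* t₂ :- b :* x₂) :- (a :* t₁ :- b :* x₁) :* (a :* t₁ :- b :* x₁)
    := a :* a :* (t₀ :* t₂ :- t₁ :* t₁) :- a :* b :* (t₂ :* x₀ :+ (:- (t₁ :+ t₁)) :* x₁ :+ t₀ :* x₂)
       :+ b :* b :* (x₀ :* x₂ :- x₁ :* x₁)) refl a t₀ t₁ t₂ b x₀ x₁ x₂

  OnLine-combine : ∀ ℓ a T b P → OnLine ℓ T → OnLine ℓ P → OnLine ℓ (combine a T b P)
  OnLine-combine (l₀ , l₁ , l₂) a (t₀ , t₁ , t₂) b (x₀ , x₁ , x₂) T∈ℓ P∈ℓ = begin
    l₀ * (a * t₀ - b * x₀) + l₁ * (a * t₁ - b * x₁) + l₂ * (a * t₂ - b * x₂)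
      ≡⟨ solve 11 (λ l₀ l₁ l₂ a t₀ t₁ t₂ b x₀ x₁ x₂ →
           l₀ :* (a :* t₀ :- b :* x₀) :+ l₁ :* (a :* t₁ :- b :* x₁) :+ l₂ :* (a :* t₂ :- b :* x₂)
           := a :* (l₀ :* t₀ :+ l₁ :* t₁ :+ l₂ :* t₂) :- b :* (l₀ :* x₀ :+ l₁ :* x₁ :+ l₂ :* x₂))
           refl l₀ l₁ l₂ a t₀ t₁ t₂ b x₀ x₁ x₂ ⟩
    a * (l₀ * t₀ + l₁ * t₁ + l₂ * t₂) - b * (l₀ * x₀ + l₁ * x₁ + l₂ * x₂)
      ≡⟨ cong₂ (λ u w → a * u - b * w) T∈ℓ P∈ℓ ⟩
    a * 0# - b * 0#
      ≡⟨ solve 2 (λ a b → a :* :0 :- b :* :0 := :0) refl a b ⟩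
    0# ∎
    where open ≡-Reasoning

  combine≡scale⇒proportional : ∀ a T b P k → combine a T b P ≡ scale k T → scale b P ≡ scale (a - k) T
  combine≡scale⇒proportional a (t₀ , t₁ , t₂) b (x₀ , x₁ , x₂) k W≡kT =
    cong₂ _,_ (solved (cong proj₁ W≡kT)) (cong₂ _,_ (solved (cong (proj₁ ∘ proj₂) W≡kT)) (solved (cong (proj₂ ∘ proj₂) W≡kT)))
    where
    solved : ∀ {t x} → a * t - b * x ≡ k * t → b * x ≡ (a - k) * t
    solved {t} {x} e = begin
      b * x                    ≡⟨ solve 3 (λ a t bx → bx := a :* t :- (a :* t :- bx)) refl a t (b * x) ⟩
      a * t - (a * t - b * x)  ≡⟨ cong (λ z → a * t - z) e ⟩
      a * t - k * t            ≡⟨ solve 3 (λ a k t → a :* t :- k :* t := (a :- k) :* t) refl a k t ⟩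
      (a - k) * t              ∎
      where open ≡-Reasoning

  IsSquare-by : ∀ {a d s b c e f} → NonZero a → a * a * d ≡ s * s - b * c + e * f → c ≡ 0# → f ≡ 0# → IsSquare d
  IsSquare-by {a} {d} {s} {b} {c} {e} {f} a≢0 identity refl refl = a*a*d≡c*c⇒IsSquare a≢0 (trans identity
    (solve 3 (λ s b e → s :* s :- b :* :0 :+ e :* :0 := s :* s) refl s b e))

  polar≡0⇒IsSquare-D : ∀ T P → NonZeroT T → OnConic T → polar T P ≡ 0# → IsSquare (D P)
  polar≡0⇒IsSquare-D (t₀ , t₁ , t₂) (x₀ , x₁ , x₂) T≢0 T∈C B≡0 with t₂ ≟ 0# | t₀ ≟ 0#
  ... | no t₂≢0 | _ = IsSquare-by t₂≢0 (solve 6 (λ t₀ t₁ t₂ x₀ x₁ x₂ →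
        t₂ :* t₂ :* (x₁ :* x₁ :- x₀ :* x₂)
        := (t₁ :* x₂ :- t₂ :* x₁) :* (t₁ :* x₂ :- t₂ :* x₁) :- x₂ :* t₂ :* (t₂ :* x₀ :+ (:- (t₁ :+ t₁)) :* x₁ :+ t₀ :* x₂)
           :+ x₂ :* x₂ :* (t₀ :* t₂ :- t₁ :* t₁)) refl t₀ t₁ t₂ x₀ x₁ x₂) B≡0 T∈C
  ... | yes _ | no t₀≢0 = IsSquare-by t₀≢0 (solve 6 (λ t₀ t₁ t₂ x₀ x₁ x₂ →
        t₀ :* t₀ :* (x₁ :* x₁ :- x₀ :* x₂)
        := (t₁ :* x₀ :- t₀ :* x₁) :* (t₁ :* x₀ :- t₀ :* x₁) :- x₀ :* t₀ :* (t₂ :* x₀ :+ (:- (t₁ :+ t₁)) :* x₁ :+ t₀ :* x₂)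
           :+ x₀ :* x₀ :* (t₀ :* t₂ :- t₁ :* t₁)) refl t₀ t₁ t₂ x₀ x₁ x₂) B≡0 T∈C
  ... | yes t₂≡0 | yes t₀≡0 = ⊥-elim (T≢0 (t₀≡0 , t₁≡0 , t₂≡0))
    where
    t₁≡0 : t₁ ≡ 0#
    t₁≡0 = x*x≡0⇒x≡0 (-x≡0⇒x≡0 (trans (solve 2 (λ t₁ t₂ → :- (t₁ :* t₁) := :0 :* t₂ :- t₁ :* t₁) refl t₁ t₂)
                                       (trans (cong (λ z → z * t₂ - t₁ * t₁) (sym t₀≡0)) T∈C)))

  -- If P lay on a tangent at T, then W = conicForm(P)·T − polar(T,P)·P would be a point of C on
  -- that line; so W ∼ T (or W = 0), forcing polar(T,P) = 0 and hence D(P) to be a square.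
  Qminus-D⇒internal : ∀ {P} → NonZeroT P → Qminus (D P) → Internal P
  Qminus-D⇒internal {P} P≢0 (DP≢0 , ¬□DP) = P≢0 , not-on-tangent
    where
    not-on-tangent : ∀ ℓ → Tangent ℓ → ¬ OnLine ℓ P
    not-on-tangent ℓ (_ , T , T≢0 , T∈C , T∈ℓ , on-ℓ∩C⇒∼T) P∈ℓ = *-nonZero (*-nonZero B≢0 B≢0) c≢0 B²c≡0
      where
      open ≡-Reasoning
      B = polar T P
      c = conicForm P
      W = combine c T B P
      B≢0 : NonZero B
      B≢0 = ¬□DP ∘ polar≡0⇒IsSquare-D T P T≢0 T∈C
      c≢0 : NonZero c
      c≢0 c≡0 = DP≢0 (trans (D≡-conicForm P) (trans (cong -_ c≡0) -0#≈0#))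
      W∈C : OnConic W
      W∈C = begin
        conicForm W                                   ≡⟨ conicForm-combine c T B P ⟩
        c * c * conicForm T - c * B * B + B * B * c   ≡⟨ cong (λ z → c * c * z - c * B * B + B * B * c) T∈C ⟩
        c * c * 0# - c * B * B + B * B * c            ≡⟨ solve 2 (λ c B → c :* c :* :0 :- c :* B :* B :+ B :* B :* c := :0) refl c B ⟩
        0#                                            ∎
      W≡kT : ∃[ k ] W ≡ scale k T
      W≡kT with (proj₁ W ≟ 0#) ×-dec (proj₁ (proj₂ W) ≟ 0#) ×-dec (proj₂ (proj₂ W) ≟ 0#)
      ... | yes (w₀≡0 , w₁≡0 , w₂≡0) = 0# , cong₂ _,_ (zero-as w₀≡0) (cong₂ _,_ (zero-as w₁≡0) (zero-as w₂≡0))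
        where
        zero-as : ∀ {w t} → w ≡ 0# → w ≡ 0# * t
        zero-as w≡0 = trans w≡0 (sym (zeroˡ _))
      ... | no W≢0 = let (k , _ , W≡kT) = on-ℓ∩C⇒∼T W W≢0 W∈C (OnLine-combine ℓ c T B P T∈ℓ P∈ℓ) in k , W≡kT
      B²c≡0 : B * B * c ≡ 0#
      B²c≡0 = let (k , W≡kT) = W≡kT in begin
        B * B * c                        ≡⟨ sym (conicForm-scale B P) ⟩
        conicForm (scale B P)            ≡⟨ cong conicForm (combine≡scale⇒proportional c T B P k W≡kT) ⟩
        conicForm (scale (c - k) T)      ≡⟨ conicForm-scale (c - k) T ⟩
        (c - k) * (c - k) * conicForm T  ≡⟨ cong ((c - k) * (c - k) *_) T∈C ⟩
        (c - k) * (c - k) * 0#           ≡⟨ zeroʳ _ ⟩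
        0#                               ∎

module Cyclic (K : FiniteField) (ω : FiniteField.F K) (ω-primitive : FiniteField.Primitive K ω)
              (n : ℕ) (order≡1+n : FiniteField.order K ≡ suc n) where
  open FiniteField K
  open FieldSolver K
  open FieldProperties K

  ω≢0 : NonZero ω
  ω≢0 = proj₁ ω-primitive

  log : ∀ x → NonZero x → ℕ
  log x x≢0 = proj₁ (proj₂ ω-primitive x x≢0)

  ω^log : ∀ x x≢0 → pow ω (log x x≢0) ≡ x
  ω^log x x≢0 = proj₂ (proj₂ ω-primitive x x≢0)

  index : F → Fin order
  index x = Any.index (elems-complete x)

  index-injective : ∀ {x y} → index x ≡ index y → x ≡ y
  index-injective {x} {y} eq = trans (lookup-index (elems-complete x))
    (trans (cong (lookup elems) eq) (sym (lookup-index (elems-complete y))))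

  order-≤ : ∀ {m} (f : F → Fin m) → (∀ {x y} → f x ≡ f y → x ≡ y) → order ℕ.≤ m
  order-≤ f f-injective = Fin.injective⇒≤ (lookup-injective sym elems-unique ∘ f-injective)

  pow-ω-collision : ∀ {i j} → i < j → pow ω i ≡ pow ω j → pow ω (j ∸ i) ≡ 1#
  pow-ω-collision {i} {j} i<j ωⁱ≡ωʲ = *-cancelˡ (pow ω i) (pow-nonZero i ω≢0) (begin
    pow ω i * pow ω (j ∸ i)   ≡⟨ sym (pow-+ ω i (j ∸ i)) ⟩
    pow ω (i ℕ.+ (j ∸ i))     ≡⟨ cong (pow ω) (ℕ.m+[n∸m]≡n (ℕ.<⇒≤ i<j)) ⟩
    pow ω j                   ≡⟨ sym ωⁱ≡ωʲ ⟩
    pow ω i                   ≡⟨ sym (*-identityʳ _) ⟩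
    pow ω i * 1#              ∎)
    where open ≡-Reasoning

  pow-ω-mod : ∀ {d} .{{_ : ℕ.NonZero d}} → pow ω d ≡ 1# → ∀ e → pow ω (e % d) ≡ pow ω e
  pow-ω-mod {d} ωᵈ≡1 e = begin
    pow ω (e % d)                  ≡⟨ sym (pow-periodic ωᵈ≡1 (e % d) (e / d)) ⟩
    pow ω (e % d ℕ.+ (e / d) ℕ.* d) ≡⟨ cong (pow ω) (sym (m≡m%n+[m/n]*n e d)) ⟩
    pow ω e                        ∎
    where open ≡-Reasoning

  powers : Fin (suc order) → F
  powers Fin.zero    = 0#
  powers (Fin.suc i) = pow ω (Fin.toℕ i)

  -- Pigeonhole on 0, ω⁰, …, ω^(q-1): two of these q + 1 elements coincide.
  ω-period-≤n : ∃[ d ] 0 < d × d ℕ.≤ n × pow ω d ≡ 1#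
  ω-period-≤n with Fin.pigeonhole (ℕ.n<1+n order) (index ∘ powers)
  ... | Fin.zero  , Fin.suc j , _         , same = ⊥-elim (pow-nonZero (Fin.toℕ j) ω≢0 (sym (index-injective same)))
  ... | Fin.suc i , Fin.suc j , s≤s i<j , same =
    Fin.toℕ j ∸ Fin.toℕ i , ℕ.m<n⇒0<n∸m i<j ,
    ℕ.≤-trans (ℕ.m∸n≤m (Fin.toℕ j) (Fin.toℕ i)) (ℕ.≤-pred (subst (suc (Fin.toℕ j) ℕ.≤_) order≡1+n (Fin.toℕ<n j))) ,
    pow-ω-collision i<j (index-injective same)

  -- A period d gives an injection of GF(q) into Fin (1 + d): 0 ↦ 0 and x ↦ 1 + (log x mod d).
  ω-period-≥n : ∀ {d} → 0 < d → pow ω d ≡ 1# → n ℕ.≤ d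
  ω-period-≥n {d} 0<d ωᵈ≡1 = ℕ.≤-pred (subst (ℕ._≤ suc d) order≡1+n (order-≤ code code-injective))
    where
    instance _ = ℕ.>-nonZero 0<d
    residue : ∀ x → NonZero x → Fin d
    residue x x≢0 = Fin.fromℕ< (m%n<n (log x x≢0) d)
    pow-residue : ∀ x x≢0 → pow ω (Fin.toℕ (residue x x≢0)) ≡ x
    pow-residue x x≢0 = trans (cong (pow ω) (Fin.toℕ-fromℕ< (m%n<n (log x x≢0) d)))
      (trans (pow-ω-mod ωᵈ≡1 (log x x≢0)) (ω^log x x≢0))
    code′ : ∀ x → Dec (x ≡ 0#) → Fin (suc d)
    code′ x (yes _)   = Fin.zero
    code′ x (no x≢0) = Fin.suc (residue x x≢0)
    code : F → Fin (suc d)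
    code x = code′ x (x ≟ 0#)
    code′-injective : ∀ {x y} x≟0 y≟0 → code′ x x≟0 ≡ code′ y y≟0 → x ≡ y
    code′-injective (yes x≡0) (yes y≡0) _ = trans x≡0 (sym y≡0)
    code′-injective (yes _)   (no _)    ()
    code′-injective (no _)    (yes _)   ()
    code′-injective {x} {y} (no x≢0) (no y≢0) same = trans (sym (pow-residue x x≢0))
      (trans (cong (pow ω ∘ Fin.toℕ) (Fin.suc-injective same)) (pow-residue y y≢0))
    code-injective : ∀ {x y} → code x ≡ code y → x ≡ y
    code-injective {x} {y} = code′-injective (x ≟ 0#) (y ≟ 0#)

  0<n : 0 < n
  0<n = let (d , 0<d , d≤n , _) = ω-period-≤n in ℕ.<-≤-trans 0<d d≤n

  ωⁿ≡1 : pow ω n ≡ 1#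
  ωⁿ≡1 = let (d , 0<d , d≤n , ωᵈ≡1) = ω-period-≤n in
    subst (λ k → pow ω k ≡ 1#) (ℕ.≤-antisym d≤n (ω-period-≥n 0<d ωᵈ≡1)) ωᵈ≡1

  pow-ω-collision-≥n : ∀ {i j} → i < j → pow ω i ≡ pow ω j → n ℕ.≤ j
  pow-ω-collision-≥n {i} {j} i<j ωⁱ≡ωʲ =
    ℕ.≤-trans (ω-period-≥n (ℕ.m<n⇒0<n∸m i<j) (pow-ω-collision i<j ωⁱ≡ωʲ)) (ℕ.m∸n≤m j i)

  pow-ω-injective : ∀ {i j} → i < n → j < n → pow ω i ≡ pow ω j → i ≡ j
  pow-ω-injective {i} {j} i<n j<n ωⁱ≡ωʲ with ℕ.<-cmp i j
  ... | tri< i<j _ _ = ⊥-elim (ℕ.<⇒≱ j<n (pow-ω-collision-≥n i<j ωⁱ≡ωʲ))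
  ... | tri≈ _ i≡j _ = i≡j
  ... | tri> _ _ j<i = ⊥-elim (ℕ.<⇒≱ i<n (pow-ω-collision-≥n j<i (sym ωⁱ≡ωʲ)))

  log< : ∀ {x} → NonZero x → ∃[ k ] k < n × pow ω k ≡ x
  log< {x} x≢0 = e % n , m%n<n e n , trans (pow-ω-mod ωⁿ≡1 e) (ω^log x x≢0)
    where
    instance _ = ℕ.>-nonZero 0<n
    e = log x x≢0

module QuadraticCharacter (K : FiniteField) (ω : FiniteField.F K) (ω-primitive : FiniteField.Primitive K ω)
                          (t : ℕ) (order≡1+2t : FiniteField.order K ≡ suc (t ℕ.+ t)) (0<t : 0 < t) where
  open FiniteField K
  open FieldSolver K
  open FieldProperties K
  open Projective K
  open Cyclic K ω ω-primitive (t ℕ.+ t) order≡1+2t public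

  pow-ω-double-mod : ∀ j → ∃[ r ] r < t × pow ω (j ℕ.+ j) ≡ pow ω (r ℕ.+ r)
  pow-ω-double-mod j = r , m%n<n j t , (begin
    pow ω (j ℕ.+ j)                           ≡⟨ cong (pow ω) j+j≡r+r+q[t+t] ⟩
    pow ω ((r ℕ.+ r) ℕ.+ q ℕ.* (t ℕ.+ t))     ≡⟨ pow-periodic ωⁿ≡1 (r ℕ.+ r) q ⟩
    pow ω (r ℕ.+ r)                           ∎)
    where
    open ≡-Reasoning
    instance _ = ℕ.>-nonZero 0<t
    r = j % t
    q = j / t
    rearrange : ∀ r q t → (r ℕ.+ q ℕ.* t) ℕ.+ (r ℕ.+ q ℕ.* t) ≡ (r ℕ.+ r) ℕ.+ q ℕ.* (t ℕ.+ t)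
    rearrange = solve-∀
    j+j≡r+r+q[t+t] : j ℕ.+ j ≡ (r ℕ.+ r) ℕ.+ q ℕ.* (t ℕ.+ t)
    j+j≡r+r+q[t+t] = trans (cong₂ ℕ._+_ (m≡m%n+[m/n]*n j t) (m≡m%n+[m/n]*n j t)) (rearrange r q t)

  square-as-pow-ω-double : ∀ {y} → NonZero y → ∃[ j ] pow ω (j ℕ.+ j) ≡ y * y
  square-as-pow-ω-double {y} y≢0 = j , trans (pow-+ ω j j) (cong₂ _*_ (ω^log y y≢0) (ω^log y y≢0))
    where j = log y y≢0

  ω-nonsquare : ¬ IsSquare ω
  ω-nonsquare (y , y²≡ω) = k+k≢1+l+l r 0 (pow-ω-injective (ℕ.+-mono-< r<t r<t) (ℕ.+-mono-≤ 0<t 0<t) (begin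
    pow ω (r ℕ.+ r)   ≡⟨ sym ω²ʲ≡ω²ʳ ⟩
    pow ω (j ℕ.+ j)   ≡⟨ ω²ʲ≡y² ⟩
    y * y             ≡⟨ y²≡ω ⟩
    ω                 ≡⟨ sym (*-identityʳ ω) ⟩
    pow ω 1           ∎))
    where
    open ≡-Reasoning
    y≢0 = square-root-nonZero ω≢0 y²≡ω
    j = proj₁ (square-as-pow-ω-double y≢0)
    ω²ʲ≡y² = proj₂ (square-as-pow-ω-double y≢0)
    r = proj₁ (pow-ω-double-mod j)
    r<t = proj₁ (proj₂ (pow-ω-double-mod j))
    ω²ʲ≡ω²ʳ = proj₂ (proj₂ (pow-ω-double-mod j))

  Qminus-ω : Qminus ω
  Qminus-ω = ω≢0 , ω-nonsquare

  Qplus-pow-ω-even : ∀ k → Qplus (pow ω (k ℕ.+ k))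
  Qplus-pow-ω-even k = subst Qplus (sym (pow-+ ω k k)) (Qplus-square (pow-nonZero k ω≢0))

  Qminus-pow-ω-odd : ∀ k → Qminus (pow ω (suc (k ℕ.+ k)))
  Qminus-pow-ω-odd k = Qminus-*-Qplus Qminus-ω (Qplus-pow-ω-even k)

  Qplus⇒pow-ω-even : ∀ {x} → Qplus x → ∃[ k ] k < t × pow ω (k ℕ.+ k) ≡ x
  Qplus⇒pow-ω-even {x} (x≢0 , y , y²≡x) =
    let (j , ω²ʲ≡y²) = square-as-pow-ω-double (square-root-nonZero x≢0 y²≡x)
        (r , r<t , ω²ʲ≡ω²ʳ) = pow-ω-double-mod j
    in r , r<t , trans (sym ω²ʲ≡ω²ʳ) (trans ω²ʲ≡y² y²≡x)

  Qminus⇒pow-ω-odd : ∀ {x} → Qminus x → ∃[ k ] k < t × pow ω (suc (k ℕ.+ k)) ≡ x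
  Qminus⇒pow-ω-odd {x} (x≢0 , ¬□) with log< x≢0
  ... | e , e<n , ωᵉ≡x with parity e
  ...   | k , inj₁ refl = ⊥-elim (¬□ (proj₂ (subst Qplus ωᵉ≡x (Qplus-pow-ω-even k))))
  ...   | k , inj₂ refl = k , k+k<l+l⇒k<l (ℕ.<-trans (ℕ.n<1+n _) e<n) , ωᵉ≡x

  Qminus-*-Qminus : ∀ {a b} → Qminus a → Qminus b → Qplus (a * b)
  Qminus-*-Qminus qa qb with Qminus⇒pow-ω-odd qa | Qminus⇒pow-ω-odd qb
  ... | k , _ , refl | l , _ , refl =
    subst Qplus (solve 3 (λ ω x y → (ω :* ω) :* (x :* y) := (ω :* x) :* (ω :* y)) refl ω (pow ω (k ℕ.+ k)) (pow ω (l ℕ.+ l)))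
      (Qplus-* (Qplus-square ω≢0) (Qplus-* (Qplus-pow-ω-even k) (Qplus-pow-ω-even l)))

  module _ (q-1 : Qplus (- 1#)) where

    -‿Qplus⁺ : ∀ {x} → Qplus x → Qplus (- x)
    -‿Qplus⁺ {x} qx = subst Qplus (-1*x≈-x x) (Qplus-* q-1 qx)

    -‿Qminus⁺ : ∀ {x} → Qminus x → Qminus (- x)
    -‿Qminus⁺ {x} qx = subst Qminus (-1*x≈-x x) (Qplus-*-Qminus q-1 qx)

  module _ (q-1 : Qminus (- 1#)) where

    -‿Qplus⁻ : ∀ {x} → Qplus x → Qminus (- x)
    -‿Qplus⁻ {x} qx = subst Qminus (-1*x≈-x x) (Qminus-*-Qplus q-1 qx)

    -‿Qminus⁻ : ∀ {x} → Qminus x → Qplus (- x)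
    -‿Qminus⁻ {x} qx = subst Qplus (-1*x≈-x x) (Qminus-*-Qminus q-1 qx)

  ωᵗ≡-1 : pow ω t ≡ - 1#
  ωᵗ≡-1 with x*x≡1⇒x≡1∨x≡-1 (trans (sym (pow-+ ω t t)) ωⁿ≡1)
  ... | inj₁ ωᵗ≡1  = ⊥-elim (ℕ.<⇒≢ 0<t (sym (pow-ω-injective (ℕ.m<m+n t 0<t) 0<n ωᵗ≡1)))
  ... | inj₂ ωᵗ≡-1 = ωᵗ≡-1

  Qplus-−1 : ∃[ s ] t ≡ s ℕ.+ s → Qplus (- 1#)
  Qplus-−1 (s , refl) = subst Qplus ωᵗ≡-1 (Qplus-pow-ω-even s)

  Qminus-−1 : ∃[ s ] t ≡ suc (s ℕ.+ s) → Qminus (- 1#)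
  Qminus-−1 (s , refl) = subst Qminus ωᵗ≡-1 (Qminus-pow-ω-odd s)

  module _ {form : F → Triple} (form-injective : ∀ {μ ν} → form μ ∼ form ν → μ ≡ ν)
           (form≢0 : ∀ μ → NonZeroT (form μ)) where

    HasSize-Image-NonZero : HasSize (Image form NonZero) (t ℕ.+ t)
    HasSize-Image-NonZero = HasSize-Image (pow ω) (t ℕ.+ t) form-injective form≢0
      (λ {k} _ → pow-nonZero k ω≢0) pow-ω-injective log<

    HasSize-Image-Qplus : HasSize (Image form Qplus) t
    HasSize-Image-Qplus = HasSize-Image (λ k → pow ω (k ℕ.+ k)) t form-injective form≢0
      (λ {k} _ → Qplus-pow-ω-even k)
      (λ i<t j<t → k+k-injective ∘ pow-ω-injective (ℕ.+-mono-< i<t i<t) (ℕ.+-mono-< j<t j<t))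
      Qplus⇒pow-ω-even

    HasSize-Image-Qminus : HasSize (Image form Qminus) t
    HasSize-Image-Qminus = HasSize-Image (λ k → pow ω (suc (k ℕ.+ k))) t form-injective form≢0
      (λ {k} _ → Qminus-pow-ω-odd k)
      (λ i<t j<t → k+k-injective ∘ ℕ.suc-injective ∘ pow-ω-injective (ℕ.+-mono-≤-< i<t i<t) (ℕ.+-mono-≤-< j<t j<t))
      Qminus⇒pow-ω-odd

module Orbits (K : FiniteField) (ω : FiniteField.F K) (ω-primitive : FiniteField.Primitive K ω)
              (t : ℕ) (order≡1+2t : FiniteField.order K ≡ suc (t ℕ.+ t)) (0<t : 0 < t) where
  open FiniteField K
  open FieldSolver K
  open FieldProperties K
  open Projective K
  open QuadraticCharacter K ω ω-primitive t order≡1+2t 0<t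

  N : F → F → Triple
  N h μ = (h * (μ * μ) , μ , 1#)

  Z : F → Triple
  Z c = (c , 0# , 1#)

  N-injective : ∀ {h μ ν} → N h μ ∼ N h ν → μ ≡ ν
  N-injective = proj₂ ∘ affine-∼-injective

  Z-injective : ∀ {μ ν} → Z μ ∼ Z ν → μ ≡ ν
  Z-injective = proj₁ ∘ affine-∼-injective

  ω⁻¹≢0 : NonZero (ω ⁻¹)
  ω⁻¹≢0 = ⁻¹-nonZero ω≢0

  Linear : (Triple → Triple) → Set
  Linear g = ∀ c v → g (scale c v) ≡ scale c (g v)

  linear-∼ : ∀ {g} → Linear g → ∀ {v w} → v ∼ w → g v ∼ g w
  linear-∼ {g} g-linear {w = w} (c , c≢0 , refl) = c , c≢0 , g-linear c w

  ∘-linear : ∀ {f g} → Linear f → Linear g → Linear (f ∘ g)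
  ∘-linear {f} {g} f-linear g-linear c v = trans (cong f (g-linear c v)) (f-linear c (g v))

  open CommutativeSemigroupProperties (CommutativeRing.*-commutativeSemigroup commutativeRing)
    using (x∙yz≈y∙xz)

  α-linear : Linear (α ω)
  α-linear c (a , b , e) = cong₂ _,_ (x∙yz≈y∙xz ω c a) (cong₂ _,_ refl (x∙yz≈y∙xz (ω ⁻¹) c e))

  α⁻¹-linear : Linear (α⁻¹ ω)
  α⁻¹-linear c (a , b , e) = cong₂ _,_ (x∙yz≈y∙xz (ω ⁻¹) c a) (cong₂ _,_ refl (x∙yz≈y∙xz ω c e))

  β-linear : Linear β
  β-linear c (a , b , e) = cong₂ _,_ refl (cong₂ _,_ (-‿distribʳ-* c b) refl)

  H₀-linear : All Linear (H₀gens ω)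
  H₀-linear = ∘-linear α-linear α-linear ∷ ∘-linear α⁻¹-linear α⁻¹-linear ∷ β-linear ∷ []

  H₁-linear : All Linear (H₁gens ω)
  H₁-linear = α-linear ∷ α⁻¹-linear ∷ β-linear ∷ []

  Invariant : List (Triple → Triple) → (F → Triple) → (F → Set) → Set
  Invariant gens form S = ∀ {g} → g ∈ gens → ∀ {μ} → S μ → ∃[ μ′ ] S μ′ × g (form μ) ∼ form μ′

  Orbit-start : ∀ {gens P v} → v ∼ P → Orbit gens P v
  Orbit-start {P = P} v∼P = P , here , v∼P

  Orbit-∼ : ∀ {gens P v w} → Orbit gens P v → w ∼ v → Orbit gens P w
  Orbit-∼ (u , P↝u , v∼u) w∼v = u , P↝u , ∼-trans w∼v v∼u

  Image-⊆-Orbit : ∀ {gens P form S} → (∀ {ν} → S ν → Orbit gens P (form ν)) → Image form S ⊆ₚ Orbit gens P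
  Image-⊆-Orbit reach v _ (ν , Sν , v∼formν) = Orbit-∼ (reach Sν) v∼formν

  module _ {gens : List (Triple → Triple)} (gens-linear : All Linear gens) where

    Orbit-step : ∀ {g P v w} → g ∈ gens → Orbit gens P v → g v ∼ w → Orbit gens P w
    Orbit-step {g} g∈gens (u , P↝u , v∼u) gv∼w =
      g u , step g g∈gens P↝u , ∼-trans (∼-sym gv∼w) (linear-∼ (All.lookup gens-linear g∈gens) v∼u)

    Orbit-⊆-Image : ∀ {form S P} → Invariant gens form S → Image form S P → Orbit gens P ⊆ₚ Image form S
    Orbit-⊆-Image {form} {S} {P} invariant P∈image v _ (w , P↝w , v∼w) =
      let (μ , Sμ , w∼formμ) = image-reach P↝w in μ , Sμ , ∼-trans v∼w w∼formμ
      where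
      image-reach : ∀ {w} → Reach gens P w → Image form S w
      image-reach here = P∈image
      image-reach (step g g∈gens P↝w) =
        let (μ , Sμ , w∼formμ) = image-reach P↝w
            (μ′ , Sμ′ , g[formμ]∼formμ′) = invariant g∈gens Sμ
        in μ′ , Sμ′ , ∼-trans (linear-∼ (All.lookup gens-linear g∈gens) w∼formμ) g[formμ]∼formμ′

  ScalesAffine : F → (Triple → Triple) → Set
  ScalesAffine m g = ∀ a b → g (a , b , 1#) ∼ (m * m * a , m * b , 1#)

  diagonal-scales : ∀ {u w} → u * w ≡ 1# → ScalesAffine w (λ (x₀ , x₁ , x₂) → (w * x₀ , x₁ , u * x₂))
  diagonal-scales {u} {w} uw≡1 a b = u , u≢0 , cong₂ _,_ (sym (begin
    u * (w * w * a)     ≡⟨ cong (u *_) (*-assoc w w a) ⟩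
    u * (w * (w * a))   ≡⟨ u[w*x]≡x (w * a) ⟩
    w * a               ∎)) (cong₂ _,_ (sym (u[w*x]≡x b)) refl)
    where
    open ≡-Reasoning
    u≢0 : NonZero u
    u≢0 u≡0 = 1#≢0# (trans (sym uw≡1) (trans (cong (_* w) u≡0) (zeroˡ w)))
    u[w*x]≡x : ∀ x → u * (w * x) ≡ x
    u[w*x]≡x x = trans (sym (*-assoc u w x)) (trans (cong (_* x) uw≡1) (*-identityˡ x))

  α-scales : ScalesAffine ω (α ω)
  α-scales = diagonal-scales (inverseˡ ω ω≢0)

  α⁻¹-scales : ScalesAffine (ω ⁻¹) (α⁻¹ ω)
  α⁻¹-scales = diagonal-scales (inverse ω ω≢0)

  ∘-scales : ∀ f g {m n} → Linear f → ScalesAffine m f → ScalesAffine n g → ScalesAffine (m * n) (f ∘ g)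
  ∘-scales f g {m} {n} f-linear f-scales g-scales a b =
    ∼-trans (linear-∼ f-linear (g-scales a b)) (∼-trans (f-scales _ _) (∼-reflexive (cong₂ _,_
      (solve 3 (λ m n a → m :* m :* (n :* n :* a) := (m :* n) :* (m :* n) :* a) refl m n a)
      (cong₂ _,_ (sym (*-assoc m n b)) refl))))

  α²-scales : ScalesAffine (ω * ω) (α ω ∘ α ω)
  α²-scales = ∘-scales (α ω) (α ω) α-linear α-scales α-scales

  α⁻²-scales : ScalesAffine (ω ⁻¹ * ω ⁻¹) (α⁻¹ ω ∘ α⁻¹ ω)
  α⁻²-scales = ∘-scales (α⁻¹ ω) (α⁻¹ ω) α⁻¹-linear α⁻¹-scales α⁻¹-scales

  N-scaled : ∀ m h μ → (m * m * (h * (μ * μ)) , m * μ , 1#) ≡ N h (m * μ)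
  N-scaled m h μ = cong₂ _,_
    (solve 3 (λ m h μ → m :* m :* (h :* (μ :* μ)) := h :* ((m :* μ) :* (m :* μ))) refl m h μ) refl

  Z-scaled : ∀ m c → (m * m * c , m * 0# , 1#) ≡ Z (m * m * c)
  Z-scaled m c = cong₂ _,_ refl (cong₂ _,_ (zeroʳ m) refl)

  scales-N : ∀ {m} g → ScalesAffine m g → ∀ h μ → g (N h μ) ∼ N h (m * μ)
  scales-N {m} _ m-scales h μ = ∼-trans (m-scales _ _) (∼-reflexive (N-scaled m h μ))

  scales-Z : ∀ {m} g → ScalesAffine m g → ∀ c → g (Z c) ∼ Z (m * m * c)
  scales-Z {m} _ m-scales c = ∼-trans (m-scales _ _) (∼-reflexive (Z-scaled m c))

  β-N : ∀ {h μ} → NonZero h → NonZero μ → β (N h μ) ∼ N h (- ((h * μ) ⁻¹))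
  β-N {h} {μ} h≢0 μ≢0 = h * (μ * μ) , *-nonZero h≢0 (*-nonZero μ≢0 μ≢0) , cong₂ _,_
    (sym (begin
      (h * (μ * μ)) * (h * ((- k) * (- k)))   ≡⟨ solve 3 (λ k h μ →
           (h :* (μ :* μ)) :* (h :* ((:- k) :* (:- k))) := (k :* (h :* μ)) :* (k :* (h :* μ))) refl k h μ ⟩
      (k * (h * μ)) * (k * (h * μ))           ≡⟨ cong (λ z → z * z) k[hμ]≡1 ⟩
      1# * 1#                                 ≡⟨ *-identityˡ 1# ⟩
      1#                                      ∎))
    (cong₂ _,_ (sym (begin
      (h * (μ * μ)) * (- k)                   ≡⟨ solve 3 (λ k h μ → (h :* (μ :* μ)) :* (:- k) := :- (μ :* (k :* (h :* μ)))) refl k h μ ⟩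
      - (μ * (k * (h * μ)))                   ≡⟨ cong (λ z → - (μ * z)) k[hμ]≡1 ⟩
      - (μ * 1#)                              ≡⟨ cong -_ (*-identityʳ μ) ⟩
      - μ                                     ∎))
    (sym (*-identityʳ _)))
    where
    open ≡-Reasoning
    k = (h * μ) ⁻¹
    k[hμ]≡1 : k * (h * μ) ≡ 1#
    k[hμ]≡1 = inverseˡ (h * μ) (*-nonZero h≢0 μ≢0)

  β-Z : ∀ {c} → NonZero c → β (Z c) ∼ Z (c ⁻¹)
  β-Z {c} c≢0 = c , c≢0 , cong₂ _,_ (sym (inverse c c≢0)) (cong₂ _,_ (trans -0#≈0# (sym (zeroʳ c))) (sym (*-identityʳ c)))

  SquareStable : (F → Set) → Set
  SquareStable S = ∀ {a μ} → Qplus a → S μ → S (a * μ)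

  NonZero-stable : SquareStable NonZero
  NonZero-stable (a≢0 , _) μ≢0 = *-nonZero a≢0 μ≢0

  stable-⁻¹ : ∀ {S} → SquareStable S → (∀ {μ} → S μ → NonZero μ) → ∀ {μ} → S μ → S (μ ⁻¹)
  stable-⁻¹ {S} stable S⊆≢0 {μ} Sμ =
    subst S (begin
      (μ ⁻¹ * μ ⁻¹) * μ   ≡⟨ *-assoc _ _ _ ⟩
      μ ⁻¹ * (μ ⁻¹ * μ)   ≡⟨ cong (μ ⁻¹ *_) (inverseˡ μ μ≢0) ⟩
      μ ⁻¹ * 1#           ≡⟨ *-identityʳ _ ⟩
      μ ⁻¹                ∎)
      (stable (Qplus-square (⁻¹-nonZero μ≢0)) Sμ)
    where
    open ≡-Reasoning
    μ≢0 = S⊆≢0 Sμ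

  invariant-H₀-N : ∀ {h S} → NonZero h → SquareStable S → (∀ {μ} → S μ → NonZero μ)
    → (∀ {μ} → S μ → S (- ((h * μ) ⁻¹))) → Invariant (H₀gens ω) (N h) S
  invariant-H₀-N {h} h≢0 stable S⊆≢0 β-closed (here refl) Sμ =
    _ , stable (Qplus-square ω≢0) Sμ , scales-N (α ω ∘ α ω) α²-scales h _
  invariant-H₀-N {h} h≢0 stable S⊆≢0 β-closed (there (here refl)) Sμ =
    _ , stable (Qplus-square ω⁻¹≢0) Sμ , scales-N (α⁻¹ ω ∘ α⁻¹ ω) α⁻²-scales h _
  invariant-H₀-N {h} h≢0 stable S⊆≢0 β-closed (there (there (here refl))) Sμ =
    _ , β-closed Sμ , β-N h≢0 (S⊆≢0 Sμ)

  invariant-H₁-N : ∀ {h} → NonZero h → Invariant (H₁gens ω) (N h) NonZero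
  invariant-H₁-N {h} h≢0 (here refl)                 μ≢0 = _ , *-nonZero ω≢0 μ≢0 , scales-N (α ω) α-scales h _
  invariant-H₁-N {h} h≢0 (there (here refl))         μ≢0 = _ , *-nonZero ω⁻¹≢0 μ≢0 , scales-N (α⁻¹ ω) α⁻¹-scales h _
  invariant-H₁-N {h} h≢0 (there (there (here refl))) μ≢0 =
    _ , -‿nonZero (⁻¹-nonZero (*-nonZero h≢0 μ≢0)) , β-N h≢0 μ≢0

  module _ {S : F → Set} (stable : SquareStable S) (S⊆≢0 : ∀ {μ} → S μ → NonZero μ) where

    invariant-H₀-Z : Invariant (H₀gens ω) Z S
    invariant-H₀-Z (here refl)                 Sc = _ , stable (Qplus-square (*-nonZero ω≢0 ω≢0)) Sc , scales-Z (α ω ∘ α ω) α²-scales _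
    invariant-H₀-Z (there (here refl))         Sc = _ , stable (Qplus-square (*-nonZero ω⁻¹≢0 ω⁻¹≢0)) Sc , scales-Z (α⁻¹ ω ∘ α⁻¹ ω) α⁻²-scales _
    invariant-H₀-Z (there (there (here refl))) Sc = _ , stable-⁻¹ stable S⊆≢0 Sc , β-Z (S⊆≢0 Sc)

    invariant-H₁-Z : Invariant (H₁gens ω) Z S
    invariant-H₁-Z (here refl)                 Sc = _ , stable (Qplus-square ω≢0) Sc , scales-Z (α ω) α-scales _
    invariant-H₁-Z (there (here refl))         Sc = _ , stable (Qplus-square ω⁻¹≢0) Sc , scales-Z (α⁻¹ ω) α⁻¹-scales _
    invariant-H₁-Z (there (there (here refl))) Sc = _ , stable-⁻¹ stable S⊆≢0 Sc , β-Z (S⊆≢0 Sc)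

  iterate : ∀ {gens g m P a b} → All Linear gens → g ∈ gens → ScalesAffine m g
    → ∀ k → Orbit gens P (a , b , 1#) → Orbit gens P (pow m k * pow m k * a , pow m k * b , 1#)
  iterate {gens} {P = P} {a} {b} _ _ _ zero P↝v = subst (Orbit gens P)
    (cong₂ _,_ (solve 1 (λ a → a := :1 :* :1 :* a) refl a) (cong₂ _,_ (sym (*-identityˡ b)) refl)) P↝v
  iterate {m = m} {a = a} {b} gens-linear g∈gens m-scales (suc k) P↝v =
    Orbit-step gens-linear g∈gens (iterate gens-linear g∈gens m-scales k P↝v)
      (∼-trans (m-scales _ _) (∼-reflexive (cong₂ _,_
        (solve 3 (λ m x a → m :* m :* (x :* x :* a) := (m :* x) :* (m :* x) :* a) refl m (pow m k) a)
        (cong₂ _,_ (sym (*-assoc m (pow m k) b)) refl))))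

  Qplus⇒pow-ω² : ∀ {r} → Qplus r → ∃[ k ] pow (ω * ω) k ≡ r
  Qplus⇒pow-ω² (r≢0 , y , y²≡r) = let k = log y (square-root-nonZero r≢0 y²≡r) in
    k , trans (pow-*-distrib ω ω k) (trans (cong₂ _*_ (ω^log y _) (ω^log y _)) y²≡r)

  reach-H₀-N : ∀ {P h μ r} → Orbit (H₀gens ω) P (N h μ) → Qplus r → Orbit (H₀gens ω) P (N h (r * μ))
  reach-H₀-N {P} {h} {μ} P↝N qr = let (k , ω²ᵏ≡r) = Qplus⇒pow-ω² qr in
    subst (λ x → Orbit (H₀gens ω) P (N h (x * μ))) ω²ᵏ≡r
      (subst (Orbit (H₀gens ω) P) (N-scaled _ h μ) (iterate H₀-linear (here refl) α²-scales k P↝N))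

  reach-H₀-Z : ∀ {P c r} → Orbit (H₀gens ω) P (Z c) → Qplus r → Orbit (H₀gens ω) P (Z (r * r * c))
  reach-H₀-Z {P} {c} P↝Z qr = let (k , ω²ᵏ≡r) = Qplus⇒pow-ω² qr in
    subst (λ x → Orbit (H₀gens ω) P (Z (x * x * c))) ω²ᵏ≡r
      (subst (Orbit (H₀gens ω) P) (Z-scaled _ c) (iterate H₀-linear (here refl) α²-scales k P↝Z))

  reach-H₁-N : ∀ {P h μ x} → Orbit (H₁gens ω) P (N h μ) → NonZero x → Orbit (H₁gens ω) P (N h (x * μ))
  reach-H₁-N {P} {h} {μ} {x} P↝N x≢0 =
    subst (λ y → Orbit (H₁gens ω) P (N h (y * μ))) (ω^log x x≢0)
      (subst (Orbit (H₁gens ω) P) (N-scaled _ h μ) (iterate H₁-linear (here refl) α-scales (log x x≢0) P↝N))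

  Orbit-H₁-N : ∀ {P h μ} → NonZero h → NonZero μ → P ∼ N h μ → Orbit (H₁gens ω) P ≐ Cstar h
  Orbit-H₁-N {P} {h} {μ} h≢0 μ≢0 P∼N =
    ⊆-antisym (Orbit-⊆-Image H₁-linear (invariant-H₁-N h≢0) (μ , μ≢0 , P∼N)) (Image-⊆-Orbit reach)
    where
    reach : ∀ {ν} → NonZero ν → Orbit (H₁gens ω) P (N h ν)
    reach {ν} ν≢0 = subst (λ z → Orbit (H₁gens ω) P (N h z)) (x*y⁻¹*y≡x ν μ≢0)
      (reach-H₁-N (Orbit-start (∼-sym P∼N)) (*-nonZero ν≢0 (⁻¹-nonZero μ≢0)))

  -- β exchanges the two square classes of the parameter exactly when −h is a non-square.
  Orbit-H₀-N-full : ∀ {P h μ} → Qminus (- h) → NonZero μ → P ∼ N h μ → Orbit (H₀gens ω) P ≐ Cstar h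
  Orbit-H₀-N-full {P} {h} {μ} q-h μ≢0 P∼N =
    ⊆-antisym (Orbit-⊆-Image H₀-linear (invariant-H₀-N h≢0 NonZero-stable id β-nonZero) (μ , μ≢0 , P∼N))
              (Image-⊆-Orbit reach)
    where
    open ≡-Reasoning
    h≢0 = -x≢0⇒x≢0 (proj₁ q-h)
    β-nonZero : ∀ {ν} → NonZero ν → NonZero (- ((h * ν) ⁻¹))
    β-nonZero ν≢0 = -‿nonZero (⁻¹-nonZero (*-nonZero h≢0 ν≢0))
    start : Orbit (H₀gens ω) P (N h μ)
    start = Orbit-start (∼-sym P∼N)
    reach : ∀ {ν} → NonZero ν → Orbit (H₀gens ω) P (N h ν)
    reach {ν} ν≢0 with Qplus⊎Qminus (*-nonZero ν≢0 (⁻¹-nonZero μ≢0))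
    ... | inj₁ q[ν/μ] = subst (λ z → Orbit (H₀gens ω) P (N h z)) (x*y⁻¹*y≡x ν μ≢0) (reach-H₀-N start q[ν/μ])
    ... | inj₂ q[ν/μ] = subst (λ z → Orbit (H₀gens ω) P (N h z)) r*μ′≡ν
        (reach-H₀-N (Orbit-step H₀-linear (there (there (here refl))) start (β-N h≢0 μ≢0))
                    (Qplus-* (Qminus-*-Qminus q-h q[ν/μ]) (Qplus-square μ≢0)))
      where
      r*μ′≡ν : (- h) * (ν * μ ⁻¹) * (μ * μ) * (- ((h * μ) ⁻¹)) ≡ ν
      r*μ′≡ν = begin
        (- h) * (ν * μ ⁻¹) * (μ * μ) * (- ((h * μ) ⁻¹))
          ≡⟨ solve 5 (λ h ν μ μ⁻¹ k → (:- h) :* (ν :* μ⁻¹) :* (μ :* μ) :* (:- k) := ν :* (μ⁻¹ :* μ) :* (k :* (h :* μ)))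
                   refl h ν μ (μ ⁻¹) ((h * μ) ⁻¹) ⟩
        ν * (μ ⁻¹ * μ) * ((h * μ) ⁻¹ * (h * μ))
          ≡⟨ cong₂ (λ a b → ν * a * b) (inverseˡ μ μ≢0) (inverseˡ (h * μ) (*-nonZero h≢0 μ≢0)) ⟩
        ν * 1# * 1#
          ≡⟨ trans (*-identityʳ _) (*-identityʳ ν) ⟩
        ν ∎

  Orbit-H₀-N-class : ∀ {P h μ S} → Qplus (- h) → SquareStable S → (∀ {ν} → S ν → NonZero ν)
    → (∀ {ν} → S ν → Qplus (ν * μ ⁻¹)) → S μ → P ∼ N h μ → Orbit (H₀gens ω) P ≐ Image (N h) S
  Orbit-H₀-N-class {P} {h} {μ} {S} q-h stable S⊆≢0 ratio Sμ P∼N =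
    ⊆-antisym (Orbit-⊆-Image H₀-linear (invariant-H₀-N h≢0 stable S⊆≢0 β-closed) (μ , Sμ , P∼N))
              (Image-⊆-Orbit reach)
    where
    h≢0 = -x≢0⇒x≢0 (proj₁ q-h)
    β-closed : ∀ {ν} → S ν → S (- ((h * ν) ⁻¹))
    β-closed {ν} Sν = subst S (begin
      (- h) * (k * k) * ν      ≡⟨ solve 3 (λ h ν k → (:- h) :* (k :* k) :* ν := :- (k :* (k :* (h :* ν)))) refl h ν k ⟩
      - (k * (k * (h * ν)))    ≡⟨ cong (λ z → - (k * z)) (inverseˡ (h * ν) hν≢0) ⟩
      - (k * 1#)               ≡⟨ cong -_ (*-identityʳ k) ⟩
      - k                      ∎) (stable (Qplus-* q-h (Qplus-square (⁻¹-nonZero hν≢0))) Sν)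
      where
      open ≡-Reasoning
      hν≢0 = *-nonZero h≢0 (S⊆≢0 Sν)
      k = (h * ν) ⁻¹
    reach : ∀ {ν} → S ν → Orbit (H₀gens ω) P (N h ν)
    reach {ν} Sν = subst (λ z → Orbit (H₀gens ω) P (N h z)) (x*y⁻¹*y≡x ν (S⊆≢0 Sμ))
      (reach-H₀-N (Orbit-start (∼-sym P∼N)) (ratio Sν))

  Orbit-H₀-N-Qplus : ∀ {P h μ} → Qplus (- h) → Qplus μ → P ∼ N h μ → Orbit (H₀gens ω) P ≐ Ohplus h
  Orbit-H₀-N-Qplus q-h qμ = Orbit-H₀-N-class q-h Qplus-* proj₁
    (λ qν → Qplus-* qν (stable-⁻¹ Qplus-* proj₁ qμ)) qμ

  Orbit-H₀-N-Qminus : ∀ {P h μ} → Qplus (- h) → Qminus μ → P ∼ N h μ → Orbit (H₀gens ω) P ≐ Ohminus h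
  Orbit-H₀-N-Qminus q-h qμ = Orbit-H₀-N-class q-h Qplus-*-Qminus proj₁
    (λ qν → Qminus-*-Qminus qν (stable-⁻¹ Qplus-*-Qminus proj₁ qμ)) qμ

  Orbit-H₀-Z : ∀ {P c} → Qminus c → P ∼ Z c → Orbit (H₀gens ω) P ≐ Oinf
  Orbit-H₀-Z {P} {c} qc P∼Z =
    ⊆-antisym (Orbit-⊆-Image H₀-linear (invariant-H₀-Z Qplus-*-Qminus proj₁) (c , qc , P∼Z)) (Image-⊆-Orbit reach)
    where
    open ≡-Reasoning
    c≢0 = proj₁ qc
    start : Orbit (H₀gens ω) P (Z c)
    start = Orbit-start (∼-sym P∼Z)
    -- ν = y²c; for a non-square y reach it instead from β(Z c) = Z (c⁻¹) as (yc)²c⁻¹, yc a square.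
    reach-via-root : ∀ {ν y} → NonZero y → y * y ≡ ν * c ⁻¹ → Orbit (H₀gens ω) P (Z ν)
    reach-via-root {ν} {y} y≢0 y²≡ν/c with Qplus⊎Qminus y≢0
    ... | inj₁ qy = subst (λ z → Orbit (H₀gens ω) P (Z z)) (begin
          y * y * c         ≡⟨ cong (_* c) y²≡ν/c ⟩
          ν * c ⁻¹ * c      ≡⟨ x*y⁻¹*y≡x ν c≢0 ⟩
          ν                 ∎) (reach-H₀-Z start qy)
    ... | inj₂ qy = subst (λ z → Orbit (H₀gens ω) P (Z z)) (begin
          (y * c) * (y * c) * c ⁻¹   ≡⟨ solve 3 (λ y c c⁻¹ → (y :* c) :* (y :* c) :* c⁻¹ := y :* y :* c :* (c :* c⁻¹)) refl y c (c ⁻¹) ⟩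
          y * y * c * (c * c ⁻¹)     ≡⟨ cong₂ (λ a b → a * c * b) y²≡ν/c (inverse c c≢0) ⟩
          ν * c ⁻¹ * c * 1#          ≡⟨ trans (*-identityʳ _) (x*y⁻¹*y≡x ν c≢0) ⟩
          ν                          ∎)
      (reach-H₀-Z (Orbit-step H₀-linear (there (there (here refl))) start (β-Z c≢0)) (Qminus-*-Qminus qy qc))
    reach : ∀ {ν} → Qminus ν → Orbit (H₀gens ω) P (Z ν)
    reach qν = let (ν/c≢0 , y , y²≡ν/c) = Qminus-*-Qminus qν (stable-⁻¹ Qplus-*-Qminus proj₁ qc) in
      reach-via-root (square-root-nonZero ν/c≢0 y²≡ν/c) y²≡ν/c

module Classification (K : FiniteField) (ω : FiniteField.F K) (ω-primitive : FiniteField.Primitive K ω)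
                      (t : ℕ) (order≡1+2t : FiniteField.order K ≡ suc (t ℕ.+ t)) (0<t : 0 < t) where
  open FiniteField K
  open FieldSolver K
  open FieldProperties K
  open Projective K
  open Conic K
  open QuadraticCharacter K ω ω-primitive t order≡1+2t 0<t
  open Orbits K ω ω-primitive t order≡1+2t 0<t

  D-N : ∀ h μ → D (N h μ) ≡ μ * μ * (1# - h)
  D-N h μ = solve 2 (λ h μ → μ :* μ :- (h :* (μ :* μ)) :* :1 := μ :* μ :* (:1 :- h)) refl h μ

  D-Z : ∀ c → D (Z c) ≡ - c
  D-Z c = solve 1 (λ c → :0 :* :0 :- c :* :1 := :- c) refl c

  internal-N : ∀ {h μ} → NonZero μ → Qminus (1# - h) → Internal (N h μ)
  internal-N {h} {μ} μ≢0 q1-h =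
    Qminus-D⇒internal (affine-nonZero _ _) (subst Qminus (sym (D-N h μ)) (Qplus-*-Qminus (Qplus-square μ≢0) q1-h))

  internal-Z : ∀ {c} → Qminus (- c) → Internal (Z c)
  internal-Z {c} q-c = Qminus-D⇒internal (affine-nonZero _ _) (subst Qminus (sym (D-Z c)) q-c)

  NormalForm : Triple → Set
  NormalForm P = (∃[ c ] Qminus (- c) × P ∼ Z c) ⊎ (∃[ h ] ∃[ μ ] NonZero μ × Qminus (1# - h) × P ∼ N h μ)

  NormalForm-∼ : ∀ {P Q} → P ∼ Q → NormalForm Q → NormalForm P
  NormalForm-∼ P∼Q (inj₁ (c , q-c , Q∼Z))           = inj₁ (c , q-c , ∼-trans P∼Q Q∼Z)
  NormalForm-∼ P∼Q (inj₂ (h , μ , μ≢0 , q1-h , Q∼N)) = inj₂ (h , μ , μ≢0 , q1-h , ∼-trans P∼Q Q∼N)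

  affine-normalForm : ∀ a b → Qminus (D (a , b , 1#)) → NormalForm (a , b , 1#)
  affine-normalForm a b qD with b ≟ 0#
  ... | yes refl = inj₁ (a , subst Qminus (D-Z a) qD , ∼-refl)
  ... | no b≢0 = inj₂ (h , b , b≢0 , Qplus-*-cancelˡ (Qplus-square b≢0) (subst Qminus (D-N h b) qD′) , ∼-reflexive A≡N)
    where
    h = a * (b ⁻¹ * b ⁻¹)
    A≡N : (a , b , 1#) ≡ N h b
    A≡N = cong₂ _,_ (sym (begin
      a * (b ⁻¹ * b ⁻¹) * (b * b)   ≡⟨ solve 3 (λ a b b⁻¹ → a :* (b⁻¹ :* b⁻¹) :* (b :* b) := a :* ((b⁻¹ :* b) :* (b⁻¹ :* b))) refl a b (b ⁻¹) ⟩
      a * ((b ⁻¹ * b) * (b ⁻¹ * b)) ≡⟨ cong (λ z → a * (z * z)) (inverseˡ b b≢0) ⟩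
      a * (1# * 1#)                 ≡⟨ cong (a *_) (*-identityˡ 1#) ⟩
      a * 1#                        ≡⟨ *-identityʳ a ⟩
      a                             ∎)) refl
      where open ≡-Reasoning
    qD′ : Qminus (D (N h b))
    qD′ = subst (Qminus ∘ D) A≡N qD

  internal-normalForm : ∀ {P} → Internal P → NormalForm P
  internal-normalForm {x₀ , x₁ , x₂} P-internal with internal⇒Qminus-D P-internal | x₂ ≟ 0#
  ... | (_ , ¬□) | yes refl = ⊥-elim (¬□ (x₁ , solve 2 (λ x₀ x₁ → x₁ :* x₁ := x₁ :* x₁ :- x₀ :* :0) refl x₀ x₁))
  ... | qD | no x₂≢0 = NormalForm-∼ (x₂ , x₂≢0 , P≡x₂A) (affine-normalForm a b
      (Qplus-*-cancelˡ (Qplus-square x₂≢0) (subst Qminus (trans (cong D P≡x₂A) (D-scale x₂ (a , b , 1#))) qD)))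
    where
    a = x₀ * x₂ ⁻¹
    b = x₁ * x₂ ⁻¹
    x₂[x*x₂⁻¹]≡x : ∀ x → x₂ * (x * x₂ ⁻¹) ≡ x
    x₂[x*x₂⁻¹]≡x x = trans (*-comm x₂ _) (x*y⁻¹*y≡x x x₂≢0)
    P≡x₂A : (x₀ , x₁ , x₂) ≡ scale x₂ (a , b , 1#)
    P≡x₂A = sym (cong₂ _,_ (x₂[x*x₂⁻¹]≡x x₀) (cong₂ _,_ (x₂[x*x₂⁻¹]≡x x₁) (*-identityʳ x₂)))

  order∸1≡t+t : order ∸ 1 ≡ t ℕ.+ t
  order∸1≡t+t = cong (_∸ 1) order≡1+2t

  [order∸1]/2≡t : (order ∸ 1) / 2 ≡ t
  [order∸1]/2≡t = trans (cong (_/ 2) (trans order∸1≡t+t (t+t≡t*2 t))) (m*n/n≡m t 2)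
    where
    t+t≡t*2 : ∀ t → t ℕ.+ t ≡ t ℕ.* 2
    t+t≡t*2 = solve-∀

  HasSize-Cstar : ∀ h → HasSize (Cstar h) (order ∸ 1)
  HasSize-Cstar h =
    subst (HasSize (Cstar h)) (sym order∸1≡t+t) (HasSize-Image-NonZero N-injective (λ _ → affine-nonZero _ _))

  HasSize-Ohplus : ∀ h → HasSize (Ohplus h) ((order ∸ 1) / 2)
  HasSize-Ohplus h =
    subst (HasSize (Ohplus h)) (sym [order∸1]/2≡t) (HasSize-Image-Qplus N-injective (λ _ → affine-nonZero _ _))

  HasSize-Ohminus : ∀ h → HasSize (Ohminus h) ((order ∸ 1) / 2)
  HasSize-Ohminus h =
    subst (HasSize (Ohminus h)) (sym [order∸1]/2≡t) (HasSize-Image-Qminus N-injective (λ _ → affine-nonZero _ _))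

  HasSize-Oinf : HasSize Oinf ((order ∸ 1) / 2)
  HasSize-Oinf =
    subst (HasSize Oinf) (sym [order∸1]/2≡t) (HasSize-Image-Qminus Z-injective (λ _ → affine-nonZero _ _))

  HasSize-Z-Qplus : HasSize (Image Z Qplus) ((order ∸ 1) / 2)
  HasSize-Z-Qplus =
    subst (HasSize (Image Z Qplus)) (sym [order∸1]/2≡t) (HasSize-Image-Qplus Z-injective (λ _ → affine-nonZero _ _))

  full⊈half : ∀ {A B} → HasSize A (order ∸ 1) → A ⊆ₚ B → HasSize B ((order ∸ 1) / 2) → ⊥
  full⊈half A-full A⊆B B-half =
    ℕ.<⇒≱ t<t+t (subst₂ ℕ._≤_ order∸1≡t+t [order∸1]/2≡t (HasSize-mono A-full A⊆B B-half))
    where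
    t<t+t : t < t ℕ.+ t
    t<t+t = ℕ.m<m+n t 0<t

  IsOrbit-≐ : ∀ {gens k S T} → S ≐ T → IsOrbitOnIOfLength gens k T → IsOrbitOnIOfLength gens k S
  IsOrbit-≐ S≐T (P , P-internal , size , T≐O) = P , P-internal , size , ≐-trans S≐T T≐O

  IsOrbit-of : ∀ {gens k P T} → Internal P → Orbit gens P ≐ T → HasSize T k → IsOrbitOnIOfLength gens k T
  IsOrbit-of P-internal O≐T T-size = _ , P-internal , HasSize-≐ (≐-sym O≐T) T-size , ≐-sym O≐T

  FullH₀Orbit HalfH₀Orbit FullH₁Orbit : PointSet → Set
  FullH₀Orbit = IsOrbitOnIOfLength (H₀gens ω) (order ∸ 1)
  HalfH₀Orbit = IsOrbitOnIOfLength (H₀gens ω) ((order ∸ 1) / 2)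
  FullH₁Orbit = IsOrbitOnIOfLength (H₁gens ω) (order ∸ 1)

  SplitIntoHalfH₀Orbits : PointSet → Set₁
  SplitIntoHalfH₀Orbits S = ∃[ S₁ ] ∃[ S₂ ] (HalfH₀Orbit S₁ × HalfH₀Orbit S₂ × S ≐ (S₁ ∪ S₂))

  Qminus-1-h⇒h≢0 : ∀ {h} → Qminus (1# - h) → NonZero h
  Qminus-1-h⇒h≢0 {h} (_ , ¬□) refl = ¬□ (1# , trans (*-identityˡ 1#)
    (sym (trans (cong (1# +_) -0#≈0#) (+-identityʳ 1#))))

  Z-orbit-not-full : ∀ {gens P c} → All Linear gens
    → (∀ {S} → SquareStable S → (∀ {μ} → S μ → NonZero μ) → Invariant gens Z S)
    → NonZero c → P ∼ Z c → ¬ HasSize (Orbit gens P) (order ∸ 1)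
  Z-orbit-not-full gens-linear invariant c≢0 P∼Z full with Qplus⊎Qminus c≢0
  ... | inj₁ qc = full⊈half full (Orbit-⊆-Image gens-linear (invariant Qplus-* proj₁) (_ , qc , P∼Z)) HasSize-Z-Qplus
  ... | inj₂ qc = full⊈half full (Orbit-⊆-Image gens-linear (invariant Qplus-*-Qminus proj₁) (_ , qc , P∼Z)) HasSize-Oinf

  N-orbit-H₀-half : ∀ {P h μ} → Qplus (- h) → NonZero μ → P ∼ N h μ
    → (Orbit (H₀gens ω) P ≐ Ohplus h) ⊎ (Orbit (H₀gens ω) P ≐ Ohminus h)
  N-orbit-H₀-half q-h μ≢0 P∼N with Qplus⊎Qminus μ≢0
  ... | inj₁ qμ = inj₁ (Orbit-H₀-N-Qplus q-h qμ P∼N)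
  ... | inj₂ qμ = inj₂ (Orbit-H₀-N-Qminus q-h qμ P∼N)

  N-orbit-H₀-half-size : ∀ {P h μ} → Qplus (- h) → NonZero μ → P ∼ N h μ
    → HasSize (Orbit (H₀gens ω) P) ((order ∸ 1) / 2)
  N-orbit-H₀-half-size q-h μ≢0 P∼N with N-orbit-H₀-half q-h μ≢0 P∼N
  ... | inj₁ O≐ = HasSize-≐ (≐-sym O≐) (HasSize-Ohplus _)
  ... | inj₂ O≐ = HasSize-≐ (≐-sym O≐) (HasSize-Ohminus _)

  FullH₀Orbit⇒Cstar : ∀ {S} → FullH₀Orbit S → ∃[ h ] Qminus (- h) × Qminus (1# - h) × S ≐ Cstar h
  FullH₀Orbit⇒Cstar (P , P-internal , full , S≐O) with internal-normalForm P-internal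
  ... | inj₁ (c , q-c , P∼Z) =
    ⊥-elim (Z-orbit-not-full H₀-linear invariant-H₀-Z (-x≢0⇒x≢0 (proj₁ q-c)) P∼Z full)
  ... | inj₂ (h , μ , μ≢0 , q1-h , P∼N) with Qplus⊎Qminus (-‿nonZero (Qminus-1-h⇒h≢0 q1-h))
  ...   | inj₁ q-h = ⊥-elim (full⊈half full (λ _ _ → id) (N-orbit-H₀-half-size q-h μ≢0 P∼N))
  ...   | inj₂ q-h = h , q-h , q1-h , ≐-trans S≐O (Orbit-H₀-N-full q-h μ≢0 P∼N)

  Cstar-FullH₀Orbit : ∀ {h} → Qminus (- h) → Qminus (1# - h) → FullH₀Orbit (Cstar h)
  Cstar-FullH₀Orbit q-h q1-h =
    IsOrbit-of (internal-N 1#≢0# q1-h) (Orbit-H₀-N-full q-h 1#≢0# ∼-refl) (HasSize-Cstar _)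

  FullH₁Orbit⇒Cstar : ∀ {S} → FullH₁Orbit S → ∃[ h ] Qminus (1# - h) × S ≐ Cstar h
  FullH₁Orbit⇒Cstar (P , P-internal , full , S≐O) with internal-normalForm P-internal
  ... | inj₁ (c , q-c , P∼Z) =
    ⊥-elim (Z-orbit-not-full H₁-linear invariant-H₁-Z (-x≢0⇒x≢0 (proj₁ q-c)) P∼Z full)
  ... | inj₂ (h , μ , μ≢0 , q1-h , P∼N) = h , q1-h , ≐-trans S≐O (Orbit-H₁-N (Qminus-1-h⇒h≢0 q1-h) μ≢0 P∼N)

  Cstar-FullH₁Orbit : ∀ {h} → Qminus (1# - h) → FullH₁Orbit (Cstar h)
  Cstar-FullH₁Orbit q1-h =
    IsOrbit-of (internal-N 1#≢0# q1-h) (Orbit-H₁-N (Qminus-1-h⇒h≢0 q1-h) 1#≢0# ∼-refl) (HasSize-Cstar _)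

  Ohplus-HalfH₀Orbit : ∀ {h} → Qplus (- h) → Qminus (1# - h) → HalfH₀Orbit (Ohplus h)
  Ohplus-HalfH₀Orbit q-h q1-h =
    IsOrbit-of (internal-N 1#≢0# q1-h) (Orbit-H₀-N-Qplus q-h Qplus-1# ∼-refl) (HasSize-Ohplus _)

  Ohminus-HalfH₀Orbit : ∀ {h} → Qplus (- h) → Qminus (1# - h) → HalfH₀Orbit (Ohminus h)
  Ohminus-HalfH₀Orbit q-h q1-h =
    IsOrbit-of (internal-N ω≢0 q1-h) (Orbit-H₀-N-Qminus q-h Qminus-ω ∼-refl) (HasSize-Ohminus _)

  Cstar≐Ohplus∪Ohminus : ∀ {h} → Cstar h ≐ (Ohplus h ∪ Ohminus h)
  Cstar≐Ohplus∪Ohminus = ⊆-antisym split (λ { _ _ (inj₁ (μ , qμ , v∼)) → μ , proj₁ qμ , v∼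
                                            ; _ _ (inj₂ (μ , qμ , v∼)) → μ , proj₁ qμ , v∼ })
    where
    split : ∀ {h} → Cstar h ⊆ₚ (Ohplus h ∪ Ohminus h)
    split _ _ (μ , μ≢0 , v∼) = [ (λ qμ → inj₁ (μ , qμ , v∼)) , (λ qμ → inj₂ (μ , qμ , v∼)) ]′ (Qplus⊎Qminus μ≢0)

  HalfH₀Orbit⊈Cstar : ∀ {h S} → Qminus (- h) → HalfH₀Orbit S → S ⊆ₚ Cstar h → ⊥
  HalfH₀Orbit⊈Cstar {h} q-h (P , P-internal , half , S≐O) S⊆C =
    let (μ , μ≢0 , P∼N) = S⊆C P P≢0 (proj₂ (S≐O P P≢0) (Orbit-start ∼-refl)) in
    full⊈half (HasSize-Cstar h) (≐⇒⊆ (≐-sym (Orbit-H₀-N-full q-h μ≢0 P∼N))) half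
    where
    P≢0 = proj₁ P-internal

  HalfH₀Orbit⇒Oinf⊎Oh : ∀ {S} → Qplus (- 1#) → HalfH₀Orbit S
    → (S ≐ Oinf) ⊎ ∃[ h ] Qplus (- h) × Qminus (1# - h) × ((S ≐ Ohplus h) ⊎ (S ≐ Ohminus h))
  HalfH₀Orbit⇒Oinf⊎Oh q-1 (P , P-internal , half , S≐O) with internal-normalForm P-internal
  ... | inj₁ (c , q-c , P∼Z) =
    inj₁ (≐-trans S≐O (Orbit-H₀-Z (subst Qminus (-‿involutive c) (-‿Qminus⁺ q-1 q-c)) P∼Z))
  ... | inj₂ (h , μ , μ≢0 , q1-h , P∼N) with Qplus⊎Qminus (-‿nonZero (Qminus-1-h⇒h≢0 q1-h))
  ...   | inj₂ q-h =
    ⊥-elim (full⊈half (HasSize-Cstar h) (≐⇒⊆ (≐-sym (Orbit-H₀-N-full q-h μ≢0 P∼N))) half)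
  ...   | inj₁ q-h =
    inj₂ (h , q-h , q1-h , Sum.map (≐-trans S≐O) (≐-trans S≐O) (N-orbit-H₀-half q-h μ≢0 P∼N))

  Oinf-HalfH₀Orbit : Qplus (- 1#) → HalfH₀Orbit Oinf
  Oinf-HalfH₀Orbit q-1 = IsOrbit-of (internal-Z (-‿Qminus⁺ q-1 Qminus-ω)) (Orbit-H₀-Z Qminus-ω ∼-refl) HasSize-Oinf

  -[1-h]≡h-1 : ∀ h → - (1# - h) ≡ h - 1#
  -[1-h]≡h-1 h = solve 1 (λ h → :- (:1 :- h) := h :- :1) refl h

  -[h-1]≡1-h : ∀ h → - (h - 1#) ≡ 1# - h
  -[h-1]≡1-h h = solve 1 (λ h → :- (h :- :1) := :1 :- h) refl h

  module NonsquareMinusOne (q-1 : Qminus (- 1#)) where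

    part-a : ∀ S → (FullH₀Orbit S → ∃[ h ] (OnePlus Qplus h × Qplus h × S ≐ Cstar h))
                 × (∃[ h ] (OnePlus Qplus h × Qplus h × S ≐ Cstar h) → FullH₀Orbit S)
    part-a S = from-orbit , to-orbit
      where
      from-orbit : FullH₀Orbit S → ∃[ h ] (OnePlus Qplus h × Qplus h × S ≐ Cstar h)
      from-orbit S-orbit = let (h , q-h , q1-h , S≐C) = FullH₀Orbit⇒Cstar S-orbit in
        h , subst Qplus (-[1-h]≡h-1 h) (-‿Qminus⁻ q-1 q1-h) , subst Qplus (-‿involutive h) (-‿Qminus⁻ q-1 q-h) , S≐C
      to-orbit : ∃[ h ] (OnePlus Qplus h × Qplus h × S ≐ Cstar h) → FullH₀Orbit S
      to-orbit (h , q[h-1] , qh , S≐C) = IsOrbit-≐ S≐C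
        (Cstar-FullH₀Orbit (-‿Qplus⁻ q-1 qh) (subst Qminus (-[h-1]≡1-h h) (-‿Qplus⁻ q-1 q[h-1])))

    part-b : ∀ S → (FullH₁Orbit S × SplitIntoHalfH₀Orbits S → ∃[ h ] (OnePlus Qplus h × Qminus h × S ≐ Cstar h))
                 × (∃[ h ] (OnePlus Qplus h × Qminus h × S ≐ Cstar h) → FullH₁Orbit S × SplitIntoHalfH₀Orbits S)
    part-b S = from-orbits , to-orbits
      where
      nonsquare-h : ∀ {h S₁} → NonZero h → HalfH₀Orbit S₁ → S₁ ⊆ₚ Cstar h → Qminus h
      nonsquare-h h≢0 S₁-orbit S₁⊆C with Qplus⊎Qminus h≢0
      ... | inj₁ qh = ⊥-elim (HalfH₀Orbit⊈Cstar (-‿Qplus⁻ q-1 qh) S₁-orbit S₁⊆C)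
      ... | inj₂ qh = qh
      from-orbits : FullH₁Orbit S × SplitIntoHalfH₀Orbits S → ∃[ h ] (OnePlus Qplus h × Qminus h × S ≐ Cstar h)
      from-orbits (S-orbit , S₁ , _ , S₁-orbit , _ , S≐S₁∪S₂) =
        let (h , q1-h , S≐C) = FullH₁Orbit⇒Cstar S-orbit in
        h , subst Qplus (-[1-h]≡h-1 h) (-‿Qminus⁻ q-1 q1-h) ,
        nonsquare-h (Qminus-1-h⇒h≢0 q1-h) S₁-orbit (λ v v≢0 → proj₁ (S≐C v v≢0) ∘ proj₂ (S≐S₁∪S₂ v v≢0) ∘ inj₁) ,
        S≐C
      to-orbits : ∃[ h ] (OnePlus Qplus h × Qminus h × S ≐ Cstar h) → FullH₁Orbit S × SplitIntoHalfH₀Orbits S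
      to-orbits (h , q[h-1] , qh , S≐C) =
        IsOrbit-≐ S≐C (Cstar-FullH₁Orbit q1-h) , Ohplus h , Ohminus h ,
        Ohplus-HalfH₀Orbit q-h q1-h , Ohminus-HalfH₀Orbit q-h q1-h , ≐-trans S≐C Cstar≐Ohplus∪Ohminus
        where
        q1-h = subst Qminus (-[h-1]≡1-h h) (-‿Qplus⁻ q-1 q[h-1])
        q-h = -‿Qminus⁻ q-1 qh

  module SquareMinusOne (q-1 : Qplus (- 1#)) where

    HalfH₀OrbitShape : PointSet → Set
    HalfH₀OrbitShape S = (S ≐ Oinf) ⊎ ∃[ h ] (OnePlus Qminus h × Qplus h × ((S ≐ Ohplus h) ⊎ (S ≐ Ohminus h)))

    part-a : ∀ S → (FullH₀Orbit S → ∃[ h ] (OnePlus Qminus h × Qminus h × S ≐ Cstar h))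
                 × (∃[ h ] (OnePlus Qminus h × Qminus h × S ≐ Cstar h) → FullH₀Orbit S)
    part-a S = from-orbit , to-orbit
      where
      from-orbit : FullH₀Orbit S → ∃[ h ] (OnePlus Qminus h × Qminus h × S ≐ Cstar h)
      from-orbit S-orbit = let (h , q-h , q1-h , S≐C) = FullH₀Orbit⇒Cstar S-orbit in
        h , subst Qminus (-[1-h]≡h-1 h) (-‿Qminus⁺ q-1 q1-h) , subst Qminus (-‿involutive h) (-‿Qminus⁺ q-1 q-h) , S≐C
      to-orbit : ∃[ h ] (OnePlus Qminus h × Qminus h × S ≐ Cstar h) → FullH₀Orbit S
      to-orbit (h , q[h-1] , qh , S≐C) = IsOrbit-≐ S≐C
        (Cstar-FullH₀Orbit (-‿Qminus⁺ q-1 qh) (subst Qminus (-[h-1]≡1-h h) (-‿Qminus⁺ q-1 q[h-1])))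

    part-b : ∀ S → (HalfH₀Orbit S → HalfH₀OrbitShape S) × (HalfH₀OrbitShape S → HalfH₀Orbit S)
    part-b S = from-orbit , to-orbit
      where
      from-orbit : HalfH₀Orbit S → HalfH₀OrbitShape S
      from-orbit S-orbit with HalfH₀Orbit⇒Oinf⊎Oh q-1 S-orbit
      ... | inj₁ S≐Oinf = inj₁ S≐Oinf
      ... | inj₂ (h , q-h , q1-h , S≐Oh) =
        inj₂ (h , subst Qminus (-[1-h]≡h-1 h) (-‿Qminus⁺ q-1 q1-h) , subst Qplus (-‿involutive h) (-‿Qplus⁺ q-1 q-h) , S≐Oh)
      to-orbit : HalfH₀OrbitShape S → HalfH₀Orbit S
      to-orbit (inj₁ S≐Oinf) = IsOrbit-≐ S≐Oinf (Oinf-HalfH₀Orbit q-1)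
      to-orbit (inj₂ (h , q[h-1] , qh , S≐Oh)) =
        [ (λ S≐ → IsOrbit-≐ S≐ (Ohplus-HalfH₀Orbit q-h q1-h)) , (λ S≐ → IsOrbit-≐ S≐ (Ohminus-HalfH₀Orbit q-h q1-h)) ]′ S≐Oh
        where
        q1-h = subst Qminus (-[h-1]≡1-h h) (-‿Qminus⁺ q-1 q[h-1])
        q-h = -‿Qplus⁺ q-1 qh

proposition2p6 : (K : FiniteField) → let open FiniteField K in
  (p f : ℕ) → Prime p → p % 2 ≡ 1 → order ≡ p ^ f → 5 < order →
  (ω : F) → Primitive ω →
  ((order % 4 ≡ 3 →
      (∀ (S : PointSet) →
         (IsOrbitOnIOfLength (H₀gens ω) (order ∸ 1) S →
            ∃[ h ] (OnePlus Qplus h × Qplus h × S ≐ Cstar h))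
       × (∃[ h ] (OnePlus Qplus h × Qplus h × S ≐ Cstar h) →
            IsOrbitOnIOfLength (H₀gens ω) (order ∸ 1) S))
    × (∀ (S : PointSet) →
         ((IsOrbitOnIOfLength (H₁gens ω) (order ∸ 1) S
            × ∃[ S₁ ] ∃[ S₂ ] (IsOrbitOnIOfLength (H₀gens ω) ((order ∸ 1) / 2) S₁
                  × IsOrbitOnIOfLength (H₀gens ω) ((order ∸ 1) / 2) S₂
                  × S ≐ (S₁ ∪ S₂))) →
            ∃[ h ] (OnePlus Qplus h × Qminus h × S ≐ Cstar h))
       × (∃[ h ] (OnePlus Qplus h × Qminus h × S ≐ Cstar h) →
            (IsOrbitOnIOfLength (H₁gens ω) (order ∸ 1) S
            × ∃[ S₁ ] ∃[ S₂ ] (IsOrbitOnIOfLength (H₀gens ω) ((order ∸ 1) / 2) S₁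
                  × IsOrbitOnIOfLength (H₀gens ω) ((order ∸ 1) / 2) S₂
                  × S ≐ (S₁ ∪ S₂))))))
  × (order % 4 ≡ 1 →
      (∀ (S : PointSet) →
         (IsOrbitOnIOfLength (H₀gens ω) (order ∸ 1) S →
            ∃[ h ] (OnePlus Qminus h × Qminus h × S ≐ Cstar h))
       × (∃[ h ] (OnePlus Qminus h × Qminus h × S ≐ Cstar h) →
            IsOrbitOnIOfLength (H₀gens ω) (order ∸ 1) S))
    × (∀ (S : PointSet) →
         (IsOrbitOnIOfLength (H₀gens ω) ((order ∸ 1) / 2) S →
            (S ≐ Oinf) ⊎ ∃[ h ] (OnePlus Qminus h × Qplus h
                                  × ((S ≐ Ohplus h) ⊎ (S ≐ Ohminus h))))
       × ((S ≐ Oinf) ⊎ ∃[ h ] (OnePlus Qminus h × Qplus h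
                                  × ((S ≐ Ohplus h) ⊎ (S ≐ Ohminus h))) →
            IsOrbitOnIOfLength (H₀gens ω) ((order ∸ 1) / 2) S))))
proposition2p6 K p f _ p-odd q≡pᶠ 5<q ω ω-primitive =
    (λ q≡3 → let open NonsquareMinusOne (−1-nonsquare q≡3) in part-a , part-b)
  , (λ q≡1 → let open SquareMinusOne (−1-square q≡1) in part-a , part-b)
  where
  open FiniteField K
  t = order / 2
  order≡1+2t : order ≡ suc (t ℕ.+ t)
  order≡1+2t = odd⇒≡1+[m/2+m/2] (subst (λ m → m % 2 ≡ 1) (sym q≡pᶠ) (odd-power f p-odd))
  0<t : 0 < t
  0<t = 5<1+2t⇒0<t (subst (5 <_) order≡1+2t 5<q)
  open QuadraticCharacter K ω ω-primitive t order≡1+2t 0<t using (Qplus-−1; Qminus-−1)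
  open Classification K ω ω-primitive t order≡1+2t 0<t
  −1-nonsquare : order % 4 ≡ 3 → Qminus (- 1#)
  −1-nonsquare q≡3 = Qminus-−1 ([1+2t]%4≡3⇒t-odd (subst (λ m → m % 4 ≡ 3) order≡1+2t q≡3))
  −1-square : order % 4 ≡ 1 → Qplus (- 1#)
  −1-square q≡1 = Qplus-−1 ([1+2t]%4≡1⇒t-even (subst (λ m → m % 4 ≡ 1) order≡1+2t q≡1))
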